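{- Let $n,h,k$ be positive integers with $\gcd(h,k)=1$, and let $u\neq 1$ be an algebraic number with $u^{h}\neq 1$ and $u^{k}\neq 1$. For positive integers $h',k'$ and $v\in\{u^{k},u^{h}\}$ put $$S_{n,u^{k}}(h,k)=\sum_{a=0}^{k-1}u^{ -ha}\,\frac{a}{k}\,\overline{H}_{n}\!\left(\frac{ha}{k},u^{k}\right),\qquad S_{n,u^{h}}(k,h)=\sum_{a=0}^{h-1}u^{ -ka}\,\frac{a}{h}\,\overline{H}_{n}\!\left(\frac{ka}{h},u^{h}\right).$$ Then $$\frac{u^{k}}{1-u^{k}}k^{n}S_{n,u^{k}}(h,k)+\frac{u^{h}}{1-u^{h}}h^{n}S_{n,u^{h}}(k,h)=\sum_{j=0}^{n}\binom{n}{j}\frac{u^{k}}{1-u^{k}}H_{j}(u^{k})k^{j}\,\frac{u^{h}}{1-u^{h}}H_{n-j}(u^{h})h^{n-j}+\frac{1}{hk}\frac{u}{1-u}H_{n+1}(u)+\frac{u}{1-u}H_{n}(u).$$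
   Context: For $v\neq 1$, the Frobenius–Euler numbers $H_n(v)$ and polynomials $H_n(x,v)$ are defined by $\frac{1-v}{e^{t}-v}=\sum_{n\ge0}H_n(v)\frac{t^n}{n!}$ and $\frac{1-v}{e^{t}-v}e^{xt}=\sum_{n\ge0}H_n(x,v)\frac{t^n}{n!}$. The Frobenius–Euler function $\overline{H}_n(x,v)$ (for real $x$) is defined by $\overline{H}_n(x,v)=H_n(x,v)$ for $0\le x<1$ and $\overline{H}_n(x+1,v)=v\,\overline{H}_n(x,v)$. The paper defines $S_{n,u}(h,k)=\sum_{a=0}^{k-1}u^{ -ha/k}\frac{a}{k}\overline{H}_n(\frac{ha}{k},u)$; with $u$ replaced by $u^k$ (resp. $u^h$ and $h,k$ swapped) this gives the sums displayed in the claim. -}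

module Defs where

open import Level using (_⊔_)
open import Data.Nat as ℕ using (ℕ; zero; suc; _∸_; _≤?_)
open import Data.Nat.DivMod using (_/_; _%_)
open import Data.Nat.Combinatorics using (_C_)
open import Data.Integer as ℤ using (ℤ; +_; -[1+_])
open import Data.List using (List; []; _∷_)
open import Data.List.Relation.Unary.Any using (Any)
open import Data.Product using (∃; _×_)
open import Relation.Nullary using (¬_; yes; no)
open import Relation.Binary.PropositionalEquality using (_≢_)
open import Algebra.Bundles using (CommutativeRing)

record Field c ℓ : Set (Level.suc (c ⊔ ℓ)) where
  field
    commutativeRing : CommutativeRing c ℓ
  open CommutativeRing commutativeRing public
  field
    _⁻¹       : Carrier → Carrier
    ⁻¹-cong   : ∀ {x y} → x ≈ y → x ⁻¹ ≈ y ⁻¹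
    ⁻¹-inverse : ∀ x → ¬ (x ≈ 0#) → x * (x ⁻¹) ≈ 1#
    0≉1       : ¬ (0# ≈ 1#)
  infix 8 _⁻¹

module FE {c ℓ} (F : Field c ℓ) where
  open Field F

  fromℕ : ℕ → Carrier
  fromℕ zero    = 0#
  fromℕ (suc n) = 1# + fromℕ n

  fromℤ : ℤ → Carrier
  fromℤ (+ n)     = fromℕ n
  fromℤ -[1+ n ]  = - fromℕ (suc n)

  infixr 9 _^_
  _^_ : Carrier → ℕ → Carrier
  x ^ zero  = 1#
  x ^ suc n = x * (x ^ n)

  CharZero : Set ℓ
  CharZero = ∀ n → n ≢ 0 → ¬ (fromℕ n ≈ 0#)

  -- evaluation of an integer polynomial given by its coefficient list
  -- (constant term first)
  evalℤ : List ℤ → Carrier → Carrier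
  evalℤ []       x = 0#
  evalℤ (a ∷ as) x = fromℤ a + x * evalℤ as x

  IsAlgebraic : Carrier → Set ℓ
  IsAlgebraic u = ∃ λ (cs : List ℤ) → Any (λ a → a ≢ + 0) cs × (evalℤ cs u ≈ 0#)

  sumTo : ℕ → (ℕ → Carrier) → Carrier
  sumTo zero    f = 0#
  sumTo (suc n) f = sumTo n f + f n

  -- Frobenius–Euler numbers H_j(v), j ≤ n, via the recurrence equivalent to
  -- the generating function (1-v)/(e^t - v):
  --   H_0 = 1,  H_m = (v-1)⁻¹ Σ_{j<m} C(m,j) H_j   (m ≥ 1)
  Hupto : Carrier → ℕ → ℕ → Carrier
  Hupto v zero    j = 1#
  Hupto v (suc n) j with j ≤? n
  ... | yes _ = Hupto v n j
  ... | no  _ = ((v - 1#) ⁻¹) * sumTo (suc n) (λ i → fromℕ (suc n C i) * Hupto v n i)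

  H : ℕ → Carrier → Carrier
  H n v = Hupto v n n

  Hpoly : ℕ → Carrier → Carrier → Carrier
  Hpoly n x v = sumTo (suc n) (λ j → fromℕ (n C j) * H j v * x ^ (n ∸ j))

  -- Frobenius–Euler function at the rational point x = m/k (m,k ∈ ℕ, k ≥ 1):
  --   H̄_n(m/k, v) = v^{⌊m/k⌋} H_n({m/k}, v)
  -- (value for k = 0 is irrelevant junk)
  Hbar : ℕ → ℕ → ℕ → Carrier → Carrier
  Hbar n m zero    v = 0#
  Hbar n m (suc k) v =
    v ^ (m / suc k) * Hpoly n (fromℕ (m % suc k) * (fromℕ (suc k)) ⁻¹) v

  S : ℕ → Carrier → ℕ → ℕ → Carrier
  S n u h k = sumTo k (λ a →
    (u ⁻¹) ^ (h ℕ.* a) * (fromℕ a * (fromℕ k) ⁻¹) * Hbar n (h ℕ.* a) k (u ^ k))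

module Submission where

open import Defs
open import Data.Nat using (ℕ; suc; _∸_; _≥_)
open import Data.Nat.GCD using (gcd)
open import Data.Nat.Combinatorics using (_C_)
open import Relation.Nullary using (¬_)
open import Relation.Binary.PropositionalEquality using (_≡_)
open import Algebra.Bundles using (CommutativeRing)

-- Everything is computed with exponential generating functions,
-- i.e. in the commutative ring of sequences under binomial convolution.  Put
-- y = u⁻¹eᵗ.  The generating function A_k(t) = uᵏ/(e^{kt} - uᵏ) of the numbers
-- (uᵏ/(1-uᵏ)) H_j(uᵏ) kʲ is the inverse of yᵏ - 1, that of (u/(1-u)) H_j(u) is
-- G = 1/(y - 1), and D G = -y G².  Multiplying A_k by yʳ = u⁻ʳe^{rt} shifts
-- the argument of the Frobenius–Euler polynomials, so the left-hand side of
-- the theorem is the n-th coefficient of  k⁻¹ P_k(y) A_k + h⁻¹ P_h(y) A_h,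
-- where P_k(y) = Σ_{a<k} a y^{ha mod k}.  The theorem is then the n-th
-- coefficient of a polynomial reciprocity law for P_k and P_h, valid in every
-- commutative ring and proved by counting lattice points, divided by
-- hk (yᵏ - 1)(yʰ - 1).

module RingToolkit {c ℓ} (R : CommutativeRing c ℓ) where
  open import Data.Nat as ℕ using (ℕ; zero; suc)
  open import Data.Integer as ℤ using (ℤ; +_; -[1+_]; _⊖_)
  import Data.Integer.Properties as ℤ
  import Data.Nat.Properties as ℕ
  open import Data.Sign as Sign using ()
  open import Data.Maybe using (Maybe; just; nothing)
  import Relation.Binary.PropositionalEquality as ≡
  open import Relation.Nullary using (yes; no)
  open import Algebra.Solver.Ring.AlmostCommutativeRing
    using (fromCommutativeRing; _-Raw-AlmostCommutative⟶_)

  open CommutativeRing R public hiding (zero)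
  open import Relation.Binary.Reasoning.Setoid setoid public
  open import Algebra.Properties.Ring ring public
    using (-‿distribˡ-*; -‿distribʳ-*; -0#≈0#; -‿involutive; -‿+-comm)
  open import Algebra.Properties.CommutativeSemigroup +-commutativeSemigroup public
    using (interchange; xy∙z≈xz∙y)
  open import Algebra.Properties.Semiring.Mult.TCOptimised semiring
    using (_×_; ×-homo-+; ×1-homo-*; 1+×)
  open import Algebra.Properties.CommutativeSemiring.Exp commutativeSemiring public
    using (_^_; ^-congˡ; ^-congʳ; ^-homo-*; ^-assocʳ; ^-distrib-*)

  -- the image of a natural number, ν n = 1# + ⋯ + 1#; this (type-checking
  -- optimised) sum has ν 1 = 1# definitionally, so the solver's constant 1 is 1#
  ν : ℕ → Carrier
  ν n = n × 1#

  ν-+ : ∀ m n → ν (m ℕ.+ n) ≈ ν m + ν n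
  ν-+ = ×-homo-+ 1#

  ν-* : ∀ m n → ν (m ℕ.* n) ≈ ν m * ν n
  ν-* = ×1-homo-*

  ν-suc : ∀ n → ν (suc n) ≈ 1# + ν n
  ν-suc n = 1+× n 1#

  1^ : ∀ n → 1# ^ n ≈ 1#
  1^ zero    = refl
  1^ (suc n) = trans (*-identityˡ _) (1^ n)

  ⟦_⟧ℤ : ℤ → Carrier
  ⟦ + n ⟧ℤ      = ν n
  ⟦ -[1+ n ] ⟧ℤ = - ν (suc n)

  cancel-common : ∀ x a b → (x + a) - (x + b) ≈ a - b
  cancel-common x a b = begin
    (x + a) - (x + b)         ≈⟨ +-congˡ (-‿+-comm x b) ⟨
    (x + a) + (- x + - b)     ≈⟨ interchange x a (- x) (- b) ⟩
    (x - x) + (a - b)         ≈⟨ +-congʳ (-‿inverseʳ x) ⟩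
    0# + (a - b)              ≈⟨ +-identityˡ _ ⟩
    a - b                     ∎

  ⊖-homo : ∀ m n → ⟦ m ⊖ n ⟧ℤ ≈ ν m - ν n
  ⊖-homo m zero = begin
    ⟦ m ⊖ 0 ⟧ℤ   ≈⟨ reflexive (≡.cong ⟦_⟧ℤ (ℤ.⊖-≥ {m} {0} ℕ.z≤n)) ⟩
    ν m          ≈⟨ +-identityʳ (ν m) ⟨
    ν m + 0#     ≈⟨ +-congˡ -0#≈0# ⟨
    ν m - 0#     ∎
  ⊖-homo zero (suc n) = sym (+-identityˡ _)
  ⊖-homo (suc m) (suc n) = begin
    ⟦ suc m ⊖ suc n ⟧ℤ       ≈⟨ reflexive (≡.cong ⟦_⟧ℤ (ℤ.[1+m]⊖[1+n]≡m⊖n m n)) ⟩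
    ⟦ m ⊖ n ⟧ℤ               ≈⟨ ⊖-homo m n ⟩
    ν m - ν n                ≈⟨ cancel-common 1# (ν m) (ν n) ⟨
    (1# + ν m) - (1# + ν n)  ≈⟨ +-cong (ν-suc m) (-‿cong (ν-suc n)) ⟨
    ν (suc m) - ν (suc n)    ∎

  ⟦⟧-+ : ∀ i j → ⟦ i ℤ.+ j ⟧ℤ ≈ ⟦ i ⟧ℤ + ⟦ j ⟧ℤ
  ⟦⟧-+ (+ m)    (+ n)    = ν-+ m n
  ⟦⟧-+ (+ m)    -[1+ n ] = ⊖-homo m (suc n)
  ⟦⟧-+ -[1+ m ] (+ n)    = trans (⊖-homo n (suc m)) (+-comm _ _)
  ⟦⟧-+ -[1+ m ] -[1+ n ] = begin
    - ν (suc (suc (m ℕ.+ n)))       ≈⟨ -‿cong (reflexive (≡.cong (λ t → ν (suc t)) (ℕ.+-suc m n))) ⟨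
    - ν (suc m ℕ.+ suc n)           ≈⟨ -‿cong (ν-+ (suc m) (suc n)) ⟩
    - (ν (suc m) + ν (suc n))       ≈⟨ -‿+-comm _ _ ⟨
    - ν (suc m) + - ν (suc n)       ∎

  ⟦⟧-neg : ∀ i → ⟦ ℤ.- i ⟧ℤ ≈ - ⟦ i ⟧ℤ
  ⟦⟧-neg (+ zero)   = sym -0#≈0#
  ⟦⟧-neg (+ suc n)  = refl
  ⟦⟧-neg -[1+ n ]   = sym (-‿involutive _)

  ⟦-n⟧ : ∀ n → ⟦ Sign.- ℤ.◃ n ⟧ℤ ≈ - ν n
  ⟦-n⟧ n = trans (reflexive (≡.cong ⟦_⟧ℤ (ℤ.-◃n≡-n n))) (⟦⟧-neg (+ n))

  ⟦⟧-* : ∀ i j → ⟦ i ℤ.* j ⟧ℤ ≈ ⟦ i ⟧ℤ * ⟦ j ⟧ℤ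
  ⟦⟧-* (+ m) (+ n) = trans (reflexive (≡.cong ⟦_⟧ℤ (ℤ.+◃n≡+n (m ℕ.* n)))) (ν-* m n)
  ⟦⟧-* (+ m) -[1+ n ] = begin
    ⟦ Sign.- ℤ.◃ (m ℕ.* suc n) ⟧ℤ    ≈⟨ ⟦-n⟧ (m ℕ.* suc n) ⟩
    - ν (m ℕ.* suc n)                ≈⟨ -‿cong (ν-* m (suc n)) ⟩
    - (ν m * ν (suc n))              ≈⟨ -‿distribʳ-* _ _ ⟩
    ν m * - ν (suc n)                ∎
  ⟦⟧-* -[1+ m ] (+ n) = begin
    ⟦ Sign.- ℤ.◃ (suc m ℕ.* n) ⟧ℤ    ≈⟨ ⟦-n⟧ (suc m ℕ.* n) ⟩
    - ν (suc m ℕ.* n)                ≈⟨ -‿cong (ν-* (suc m) n) ⟩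
    - (ν (suc m) * ν n)              ≈⟨ -‿distribˡ-* _ _ ⟩
    - ν (suc m) * ν n                ∎
  ⟦⟧-* -[1+ m ] -[1+ n ] = begin
    ν (suc m ℕ.* suc n)              ≈⟨ ν-* (suc m) (suc n) ⟩
    ν (suc m) * ν (suc n)            ≈⟨ *-congʳ (-‿involutive _) ⟨
    - - ν (suc m) * ν (suc n)        ≈⟨ -‿distribˡ-* _ _ ⟨
    - (- ν (suc m) * ν (suc n))      ≈⟨ -‿distribʳ-* _ _ ⟩
    - ν (suc m) * - ν (suc n)        ∎

  ℤ-morphism : ℤ.+-*-rawRing -Raw-AlmostCommutative⟶ fromCommutativeRing R
  ℤ-morphism = record
    { ⟦_⟧ = ⟦_⟧ℤ ; +-homo = ⟦⟧-+ ; *-homo = ⟦⟧-* ; -‿homo = ⟦⟧-neg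
    ; 0-homo = refl ; 1-homo = refl }

  -- coefficient equality is only detected when it is syntactic
  ℤ-equal? : ∀ i j → Maybe (⟦ i ⟧ℤ ≈ ⟦ j ⟧ℤ)
  ℤ-equal? i j with i ℤ.≟ j
  ... | yes ≡.refl = just refl
  ... | no _       = nothing

  open import Algebra.Solver.Ring ℤ.+-*-rawRing (fromCommutativeRing R) ℤ-morphism ℤ-equal? public
    using (solve; _:+_; _:*_; _:-_; :-_; con; _:=_)


module FiniteSums {c ℓ} (R : CommutativeRing c ℓ) where
  open import Data.Nat as ℕ using (ℕ; zero; suc; _<_; _≤_)
  import Data.Nat.Properties as ℕ
  open import Data.Fin as Fin using (Fin; toℕ; fromℕ<)
  import Data.Fin.Properties as Fin
  open import Data.Fin.Permutation using (Permutation; permutation; _⟨$⟩ʳ_)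
  open import Data.Integer using (+_)
  open import Data.Empty using (⊥-elim)
  open import Relation.Nullary using (Dec; yes; no; ¬_)
  open import Relation.Binary.PropositionalEquality as ≡ using (_≡_)

  open RingToolkit R public

  Σ : ℕ → (ℕ → Carrier) → Carrier
  Σ zero    f = 0#
  Σ (suc n) f = Σ n f + f n

  Σ-cong : ∀ n {f g} → (∀ i → i < n → f i ≈ g i) → Σ n f ≈ Σ n g
  Σ-cong zero    f≈g = refl
  Σ-cong (suc n) f≈g = +-cong (Σ-cong n (λ i i<n → f≈g i (ℕ.m<n⇒m<1+n i<n))) (f≈g n ℕ.≤-refl)

  Σ-cong′ : ∀ n {f g} → (∀ i → f i ≈ g i) → Σ n f ≈ Σ n g
  Σ-cong′ n f≈g = Σ-cong n (λ i _ → f≈g i)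

  Σ-zero : ∀ n {f} → (∀ i → i < n → f i ≈ 0#) → Σ n f ≈ 0#
  Σ-zero zero    f≈0 = refl
  Σ-zero (suc n) f≈0 = trans (+-cong (Σ-zero n (λ i i<n → f≈0 i (ℕ.m<n⇒m<1+n i<n))) (f≈0 n ℕ.≤-refl)) (+-identityʳ 0#)

  Σ-+ : ∀ n f g → Σ n (λ i → f i + g i) ≈ Σ n f + Σ n g
  Σ-+ zero    f g = sym (+-identityˡ 0#)
  Σ-+ (suc n) f g = trans (+-congʳ (Σ-+ n f g)) (interchange _ _ _ _)

  Σ-*ˡ : ∀ n x f → x * Σ n f ≈ Σ n (λ i → x * f i)
  Σ-*ˡ zero    x f = zeroʳ x
  Σ-*ˡ (suc n) x f = trans (distribˡ _ _ _) (+-congʳ (Σ-*ˡ n x f))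

  Σ-first : ∀ n f → Σ (suc n) f ≈ f 0 + Σ n (λ i → f (suc i))
  Σ-first zero    f = trans (+-identityˡ _) (sym (+-identityʳ _))
  Σ-first (suc n) f = trans (+-congʳ (Σ-first n f)) (+-assoc _ _ _)

  Σ-swap : ∀ m n (F : ℕ → ℕ → Carrier) →
           Σ m (λ i → Σ n (F i)) ≈ Σ n (λ j → Σ m (λ i → F i j))
  Σ-swap zero    n F = sym (Σ-zero n (λ _ _ → refl))
  Σ-swap (suc m) n F = trans (+-congʳ (Σ-swap m n F)) (sym (Σ-+ n _ _))

  [_]·_ : ∀ {p} {P : Set p} → Dec P → Carrier → Carrier
  [ yes _ ]· x = x
  [ no _  ]· x = 0#

  [yes]· : ∀ {p} {P : Set p} (d : Dec P) → P → ∀ x → [ d ]· x ≈ x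
  [yes]· (yes _) _ x = refl
  [yes]· (no ¬p) p x = ⊥-elim (¬p p)

  [no]· : ∀ {p} {P : Set p} (d : Dec P) → ¬ P → ∀ x → [ d ]· x ≈ 0#
  [no]· (yes p) ¬p x = ⊥-elim (¬p p)
  [no]· (no _)  _  x = refl

  *-[]· : ∀ {p} {P : Set p} (d : Dec P) x z → x * [ d ]· z ≈ [ d ]· (x * z)
  *-[]· (yes _) x z = refl
  *-[]· (no _)  x z = zeroʳ x

  Σ-delta : ∀ n a₀ (F : ℕ → Carrier) → a₀ < n → Σ n (λ a → [ a ℕ.≟ a₀ ]· F a) ≈ F a₀
  Σ-delta (suc n) a₀ F a₀<1+n with a₀ ℕ.≟ n
  ... | yes ≡.refl = begin
    Σ n (λ a → [ a ℕ.≟ a₀ ]· F a) + [ a₀ ℕ.≟ a₀ ]· F a₀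
      ≈⟨ +-cong (Σ-zero n (λ a a<n → [no]· (a ℕ.≟ a₀) (λ a≡a₀ → ℕ.<-irrefl a≡a₀ a<n) _))
                ([yes]· (a₀ ℕ.≟ a₀) ≡.refl _) ⟩
    0# + F a₀ ≈⟨ +-identityˡ _ ⟩
    F a₀      ∎
  ... | no a₀≢n = trans (+-congˡ ([no]· (n ℕ.≟ a₀) (λ n≡a₀ → a₀≢n (≡.sym n≡a₀)) _))
                  (trans (+-identityʳ _) (Σ-delta n a₀ F (ℕ.≤∧≢⇒< (ℕ.≤-pred a₀<1+n) a₀≢n)))

  Σ-permute : ∀ n (φ ψ : ℕ → ℕ) (g : ℕ → Carrier) →
              (∀ a → a < n → φ a < n) → (∀ a → a < n → ψ a < n) →
              (∀ a → a < n → φ (ψ a) ≡ a) → (∀ a → a < n → ψ (φ a) ≡ a) →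
              Σ n (λ a → g (φ a)) ≈ Σ n g
  Σ-permute n φ ψ g φ< ψ< φψ ψφ = begin
    Σ n (λ a → g (φ a))                  ≈⟨ Σ-as-sum n _ ⟩
    sum {n} (λ i → g (φ (toℕ i)))        ≈⟨ sum-cong-≋ {n} (λ i → reflexive (≡.cong g (≡.sym (Fin.toℕ-fromℕ< _)))) ⟩
    sum {n} (λ i → g (toℕ (π ⟨$⟩ʳ i)))   ≈⟨ sum-permute (λ i → g (toℕ i)) π ⟨
    sum {n} (λ i → g (toℕ i))            ≈⟨ Σ-as-sum n g ⟨
    Σ n g                                ∎
    where
    open import Algebra.Properties.CommutativeMonoid.Sum +-commutativeMonoid using (sum-permute; sum-cong-≋)
    open import Algebra.Definitions.RawMonoid +-rawMonoid using (sum)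

    Σ-as-sum : ∀ n (g : ℕ → Carrier) → Σ n g ≈ sum {n} (λ i → g (toℕ i))
    Σ-as-sum zero    g = refl
    Σ-as-sum (suc n) g = trans (Σ-first n g) (+-congˡ (Σ-as-sum n (λ i → g (suc i))))

    restrict : (θ : ℕ → ℕ) → (∀ a → a < n → θ a < n) → Fin n → Fin n
    restrict θ θ< i = fromℕ< (θ< (toℕ i) (Fin.toℕ<n i))

    inverse : ∀ θ θ′ θ< θ′< → (∀ a → a < n → θ (θ′ a) ≡ a) →
              ∀ i → restrict θ θ< (restrict θ′ θ′< i) ≡ i
    inverse θ θ′ θ< θ′< θθ′ i = Fin.toℕ-injective
      (≡.trans (Fin.toℕ-fromℕ< _) (≡.trans (≡.cong θ (Fin.toℕ-fromℕ< _)) (θθ′ (toℕ i) (Fin.toℕ<n i))))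

    π : Permutation n n
    π = permutation (restrict φ φ<) (restrict ψ ψ<) (inverse φ ψ φ< ψ< φψ) (inverse ψ φ ψ< φ< ψφ)

  Σ-by-parts : ∀ n (F : ℕ → Carrier) →
               Σ n (λ a → ν a * (F (suc a) - F a)) + Σ n (λ a → F (suc a)) ≈ ν n * F n
  Σ-by-parts zero    F = trans (+-identityˡ _) (sym (zeroˡ _))
  Σ-by-parts (suc n) F = begin
    (Σ n (λ a → ν a * (F (suc a) - F a)) + ν n * (F (suc n) - F n)) + (Σ n (λ a → F (suc a)) + F (suc n))
      ≈⟨ interchange _ _ _ _ ⟩
    (Σ n (λ a → ν a * (F (suc a) - F a)) + Σ n (λ a → F (suc a))) + (ν n * (F (suc n) - F n) + F (suc n))
      ≈⟨ +-congʳ (Σ-by-parts n F) ⟩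
    ν n * F n + (ν n * (F (suc n) - F n) + F (suc n))
      ≈⟨ solve 3 (λ N A B → N :* A :+ (N :* (B :- A) :+ B) := (con (+ 1) :+ N) :* B) refl (ν n) (F n) (F (suc n)) ⟩
    (1# + ν n) * F (suc n)
      ≈⟨ *-congʳ (ν-suc n) ⟨
    ν (suc n) * F (suc n) ∎

  Σ-shift : ∀ n (F : ℕ → Carrier) → Σ n (λ a → F (suc a)) + F 0 ≈ Σ n F + F n
  Σ-shift zero    F = refl
  Σ-shift (suc n) F = begin
    (Σ n (λ a → F (suc a)) + F (suc n)) + F 0 ≈⟨ xy∙z≈xz∙y _ _ _ ⟩
    (Σ n (λ a → F (suc a)) + F 0) + F (suc n) ≈⟨ +-congʳ (Σ-shift n F) ⟩
    (Σ n F + F n) + F (suc n)                 ∎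

  module Telescope (g : ℕ → Carrier) (lo hi : ℕ) (lo≤hi : lo ≤ hi) where
    step : ℕ → Carrier
    step b = [ lo ℕ.≤? b ]· ([ b ℕ.<? hi ]· (g (suc b) - g b))

    below : ∀ n → n ≤ lo → Σ n step ≈ 0#
    below n n≤lo = Σ-zero n (λ b b<n → [no]· (lo ℕ.≤? b) (λ lo≤b → ℕ.<-irrefl ≡.refl (ℕ.<-≤-trans (ℕ.<-≤-trans b<n n≤lo) lo≤b)) _)

    inside : ∀ d → lo ℕ.+ d ≤ hi → Σ (lo ℕ.+ d) step ≈ g (lo ℕ.+ d) - g lo
    inside zero _ = begin
      Σ (lo ℕ.+ 0) step ≈⟨ below (lo ℕ.+ 0) (ℕ.≤-reflexive (ℕ.+-identityʳ lo)) ⟩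
      0#                ≈⟨ -‿inverseʳ (g lo) ⟨
      g lo - g lo       ≈⟨ +-congʳ (reflexive (≡.cong g (≡.sym (ℕ.+-identityʳ lo)))) ⟩
      g (lo ℕ.+ 0) - g lo ∎
    inside (suc d) lo+1+d≤hi = begin
      Σ (lo ℕ.+ suc d) step
        ≈⟨ reflexive (≡.cong (λ m → Σ m step) (ℕ.+-suc lo d)) ⟩
      Σ (lo ℕ.+ d) step + step (lo ℕ.+ d)
        ≈⟨ +-cong (inside d (ℕ.≤-trans (ℕ.+-monoʳ-≤ lo (ℕ.n≤1+n d)) lo+1+d≤hi))
                  (trans ([yes]· (lo ℕ.≤? lo ℕ.+ d) (ℕ.m≤m+n lo d) _)
                         ([yes]· (lo ℕ.+ d ℕ.<? hi) (ℕ.≤-trans (ℕ.≤-reflexive (≡.sym (ℕ.+-suc lo d))) lo+1+d≤hi) _)) ⟩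
      (g (lo ℕ.+ d) - g lo) + (g (suc (lo ℕ.+ d)) - g (lo ℕ.+ d))
        ≈⟨ solve 3 (λ a b c → (a :- b) :+ (c :- a) := c :- b) refl _ _ _ ⟩
      g (suc (lo ℕ.+ d)) - g lo
        ≈⟨ +-congʳ (reflexive (≡.cong g (≡.sym (ℕ.+-suc lo d)))) ⟩
      g (lo ℕ.+ suc d) - g lo ∎

    beyond : ∀ d → Σ (hi ℕ.+ d) step ≈ g hi - g lo
    beyond zero = begin
      Σ (hi ℕ.+ 0) step
        ≈⟨ reflexive (≡.cong (λ m → Σ m step) (≡.trans (ℕ.+-identityʳ hi) (≡.sym (ℕ.m+[n∸m]≡n lo≤hi)))) ⟩
      Σ (lo ℕ.+ (hi ℕ.∸ lo)) step
        ≈⟨ inside (hi ℕ.∸ lo) (ℕ.≤-reflexive (ℕ.m+[n∸m]≡n lo≤hi)) ⟩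
      g (lo ℕ.+ (hi ℕ.∸ lo)) - g lo
        ≈⟨ +-congʳ (reflexive (≡.cong g (ℕ.m+[n∸m]≡n lo≤hi))) ⟩
      g hi - g lo ∎
    beyond (suc d) = begin
      Σ (hi ℕ.+ suc d) step
        ≈⟨ reflexive (≡.cong (λ m → Σ m step) (ℕ.+-suc hi d)) ⟩
      Σ (hi ℕ.+ d) step + step (hi ℕ.+ d)
        ≈⟨ +-cong (beyond d)
             (trans ([yes]· (lo ℕ.≤? hi ℕ.+ d) (ℕ.≤-trans lo≤hi (ℕ.m≤m+n hi d)) _)
                    ([no]· (hi ℕ.+ d ℕ.<? hi) (λ lt → ℕ.<-irrefl ≡.refl (ℕ.<-≤-trans lt (ℕ.m≤m+n hi d))) _)) ⟩
      (g hi - g lo) + 0# ≈⟨ +-identityʳ _ ⟩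
      g hi - g lo        ∎

    telescope : ∀ n → hi ≤ n → Σ n step ≈ g hi - g lo
    telescope n hi≤n = trans (reflexive (≡.cong (λ m → Σ m step) (≡.sym (ℕ.m+[n∸m]≡n hi≤n)))) (beyond (n ℕ.∸ hi))

module FloorArithmetic where
  open import Data.Nat
  open import Data.Nat.Properties
  open import Data.Nat.DivMod
  open import Data.Nat.Tactic.RingSolver using (solve-∀)
  open import Data.Product using (_×_; _,_; ∃; proj₁; proj₂)
  open import Data.Nat.GCD using (gcd; module Bézout)
  open import Data.Nat.Coprimality using (gcd≡1⇒coprime; coprime-Bézout)
  open import Relation.Binary.PropositionalEquality
  open import Relation.Nullary using (yes; no)
  open import Data.Empty using (⊥-elim)

  ≤/⇒*≤ : ∀ m x d .{{_ : NonZero d}} → x ≤ m / d → d * x ≤ m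
  ≤/⇒*≤ m x d x≤ = ≤-trans (≤-trans (*-monoʳ-≤ d x≤) (≤-reflexive (*-comm d (m / d)))) (m/n*n≤m m d)

  *≤⇒≤/ : ∀ m x d .{{_ : NonZero d}} → d * x ≤ m → x ≤ m / d
  *≤⇒≤/ m x d dx≤m with x ≤? m / d
  ... | yes x≤ = x≤
  ... | no x≰ = ⊥-elim (<-irrefl refl (≤-<-trans dx≤m m<dx))
    where
    m<dx : m < d * x
    m<dx = begin-strict
      m                  ≡⟨ m≡m%n+[m/n]*n m d ⟩
      m % d + m / d * d  <⟨ +-monoˡ-< (m / d * d) (m%n<n m d) ⟩
      d + m / d * d      ≡⟨ trans (cong (d +_) (*-comm (m / d) d)) (sym (*-suc d (m / d))) ⟩
      d * suc (m / d)    ≤⟨ *-monoʳ-≤ d (≰⇒> x≰) ⟩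
      d * x              ∎
      where open ≤-Reasoning

  <*⇒/< : ∀ m x d .{{_ : NonZero d}} → m < d * x → m / d < x
  <*⇒/< m x d m<dx = ≰⇒> (λ x≤ → <-irrefl refl (<-≤-trans m<dx (≤/⇒*≤ m x d x≤)))

  /<⇒<* : ∀ m x d .{{_ : NonZero d}} → m / d < x → m < d * x
  /<⇒<* m x d m/d<x = ≰⇒> (λ dx≤m → <-irrefl refl (<-≤-trans m/d<x (*≤⇒≤/ m x d dx≤m)))

  swap-≤ : ∀ a b c d → a + b ≡ c + d → a ≤ d → c ≤ b
  swap-≤ a b c d eq a≤d = +-cancelʳ-≤ d c b (begin
    c + d ≡⟨ sym eq ⟩ a + b ≡⟨ +-comm a b ⟩ b + a ≤⟨ +-monoʳ-≤ b a≤d ⟩ b + d ∎)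
    where open ≤-Reasoning

  swap-< : ∀ a b c d → a + b ≡ c + d → d < a → b < c
  swap-< a b c d eq d<a = ≰⇒> (λ c≤b → <-irrefl refl (<-≤-trans d<a (swap-≤ c d a b (sym eq) c≤b)))

  ∸-swap-≤ : ∀ m n o → m ∸ n ≤ o → m ∸ o ≤ n
  ∸-swap-≤ m n o m∸n≤o =
    m≤n+o⇒m∸n≤o m o (≤-trans (≤-trans (m≤n+m∸n m n) (+-monoʳ-≤ n m∸n≤o)) (≤-reflexive (+-comm n o)))

  ∸-swap-< : ∀ m n o → o < m ∸ n → n < m ∸ o
  ∸-swap-< m n o o<m∸n = ≰⇒> (λ m∸o≤n → <-irrefl refl (<-≤-trans o<m∸n (∸-swap-≤ m o n m∸o≤n)))

  ∸-intro : ∀ {x y z} → x ≡ z + y → x ∸ y ≡ z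
  ∸-intro {x} {y} {z} eq = trans (cong (_∸ y) eq) (m+n∸n≡m z y)

  *-%-absorb : ∀ m n d .{{_ : NonZero d}} → (m * (n % d)) % d ≡ (m * n) % d
  *-%-absorb m n d = begin
    (m * (n % d)) % d              ≡⟨ %-distribˡ-* m (n % d) d ⟩
    ((m % d) * (n % d % d)) % d    ≡⟨ cong (λ z → ((m % d) * z) % d) (m%n%n≡m%n n d) ⟩
    ((m % d) * (n % d)) % d        ≡⟨ %-distribˡ-* m n d ⟨
    (m * n) % d                    ∎
    where open ≡-Reasoning

  -- If gcd h k = 1 then a ↦ h a mod k is a permutation of {0,…,k-1}:
  -- Bézout gives h′ with h′ h a ≡ a (mod k), so a ↦ h′ a mod k inverts it.
  module ResiduePermutation (h k : ℕ) {{_ : NonZero k}} (coprime : gcd h k ≡ 1) where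

    inverse-mod : ∃ λ h′ → ∀ a → (h′ * (h * a)) % k ≡ a % k
    inverse-mod with coprime-Bézout (gcd≡1⇒coprime coprime)
    ... | Bézout.+- x y eq = x , λ a → trans (cong (_% k) (lemma a)) ([m+kn]%n≡m%n a (y * a) k)
      where
      lemma : ∀ a → x * (h * a) ≡ a + y * a * k
      lemma a = begin
        x * (h * a)      ≡⟨ sym (*-assoc x h a) ⟩
        x * h * a        ≡⟨ cong (_* a) (sym eq) ⟩
        (1 + y * k) * a  ≡⟨ ring y k a ⟩
        a + y * a * k    ∎
        where open ≡-Reasoning
              ring : ∀ y k a → (1 + y * k) * a ≡ a + y * a * k
              ring = solve-∀
    ... | Bézout.-+ x y eq = x * pred k , λ a →
            trans (sym ([m+kn]%n≡m%n (x * pred k * (h * a)) a k))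
                  (trans (cong (_% k) (lemma a)) ([m+kn]%n≡m%n a (y * pred k * a) k))
      where
      lemma : ∀ a → x * pred k * (h * a) + a * k ≡ a + y * pred k * a * k
      lemma a = begin
        x * pred k * (h * a) + a * k            ≡⟨ cong (λ z → x * pred k * (h * a) + a * z) (sym (suc-pred k)) ⟩
        x * pred k * (h * a) + a * suc (pred k) ≡⟨ ring₁ x (pred k) h a ⟩
        pred k * a * (1 + x * h) + a            ≡⟨ cong (λ z → pred k * a * z + a) eq ⟩
        pred k * a * (y * k) + a                ≡⟨ ring₂ (pred k) a y k ⟩
        a + y * pred k * a * k                  ∎
        where open ≡-Reasoning
              ring₁ : ∀ x p h a → x * p * (h * a) + a * suc p ≡ p * a * (1 + x * h) + a
              ring₁ = solve-∀
              ring₂ : ∀ p a y k → p * a * (y * k) + a ≡ a + y * p * a * k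
              ring₂ = solve-∀

    h′ : ℕ
    h′ = proj₁ inverse-mod

    φ ψ : ℕ → ℕ
    φ a = (h * a) % k
    ψ a = (h′ * a) % k

    φ< : ∀ a → a < k → φ a < k
    φ< a _ = m%n<n _ k

    ψ< : ∀ a → a < k → ψ a < k
    ψ< a _ = m%n<n _ k

    ψφ : ∀ a → a < k → ψ (φ a) ≡ a
    ψφ a a<k = trans (*-%-absorb h′ (h * a) k) (trans (proj₂ inverse-mod a) (m<n⇒m%n≡m a<k))

    φψ : ∀ a → a < k → φ (ψ a) ≡ a
    φψ a a<k = trans (*-%-absorb h (h′ * a) k)
                 (trans (cong (_% k) (x[yz]≡y[xz] h h′ a)) (trans (proj₂ inverse-mod a) (m<n⇒m%n≡m a<k)))
      where x[yz]≡y[xz] : ∀ x y z → x * (y * z) ≡ y * (x * z)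
            x[yz]≡y[xz] = solve-∀

  -- For a < k the
  -- numbers b < h with  lo a ≤ b < hi a  (lo a = h - q(a+1), hi a = h - q a)
  -- are exactly those whose "block" k - 1 - ⌊kb/h⌋ equals a; along such a
  -- block the exponent e a b = h(a+1) - k(h-b) increases in steps of k from
  -- r(a+1) to r a + h, and at b itself it equals the residue kb mod h.
  module Blocks (h k : ℕ) {{_ : NonZero h}} {{_ : NonZero k}} where
    q r f s block : ℕ → ℕ
    q a = (h * a) / k
    r a = (h * a) % k
    f b = (k * b) / h
    s b = (k * b) % h
    block b = k ∸ suc (f b)

    e : ℕ → ℕ → ℕ
    e a b = h * suc a ∸ k * (h ∸ b)

    lo hi : ℕ → ℕ
    lo a = h ∸ q (suc a)
    hi a = h ∸ q a

    h*a≡ : ∀ a → h * a ≡ r a + q a * k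
    h*a≡ a = m≡m%n+[m/n]*n (h * a) k

    k*b≡ : ∀ b → k * b ≡ s b + f b * h
    k*b≡ b = m≡m%n+[m/n]*n (k * b) h

    r-zero : r 0 ≡ 0
    r-zero = trans (cong (_% k) (*-zeroʳ h)) (m<n⇒m%n≡m (>-nonZero⁻¹ k))

    r-k : r k ≡ 0
    r-k = m*n%n≡0 h k

    q≤h : ∀ a → a ≤ k → q a ≤ h
    q≤h a a≤k = ≤-trans (/-monoˡ-≤ k (*-monoʳ-≤ h a≤k)) (≤-reflexive (m*n/n≡m h k))

    lo≤hi : ∀ a → lo a ≤ hi a
    lo≤hi a = ∸-monoʳ-≤ h (/-monoˡ-≤ k (*-monoʳ-≤ h (n≤1+n a)))

    hi≤h : ∀ a → hi a ≤ h
    hi≤h a = m∸n≤m h (q a)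

    f<k : ∀ b → b < h → f b < k
    f<k b b<h = m<n*o⇒m/o<n (*-monoʳ-< k b<h)

    block<k : ∀ b → b < h → block b < k
    block<k b b<h = ∸-monoʳ-< {k} {suc (f b)} {0} z<s (f<k b b<h)

    block+f : ∀ b → b < h → suc (block b) + f b ≡ k
    block+f b b<h = trans (sym (+-suc (block b) (f b))) (m∸n+n≡m (f<k b b<h))

    k∸[k∸1+a] : ∀ a → a < k → k ∸ suc (k ∸ suc a) ≡ a
    k∸[k∸1+a] a a<k = ∸-intro (trans (sym (m∸n+n≡m a<k)) (trans (+-suc (k ∸ suc a) a) (+-comm (suc (k ∸ suc a)) a)))

    -- both sides equal hk
    hk-split : ∀ a b → a < k → b ≤ h → h * (k ∸ suc a) + h * suc a ≡ k * (h ∸ b) + k * b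
    hk-split a b a<k b≤h = begin
      h * (k ∸ suc a) + h * suc a  ≡⟨ *-distribˡ-+ h (k ∸ suc a) (suc a) ⟨
      h * ((k ∸ suc a) + suc a)    ≡⟨ cong (h *_) (m∸n+n≡m a<k) ⟩
      h * k                        ≡⟨ *-comm h k ⟩
      k * h                        ≡⟨ cong (k *_) (m∸n+n≡m b≤h) ⟨
      k * ((h ∸ b) + b)            ≡⟨ *-distribˡ-+ k (h ∸ b) b ⟩
      k * (h ∸ b) + k * b          ∎
      where open ≡-Reasoning

    hk-split′ : ∀ a b → a < k → b ≤ h → h * suc (k ∸ suc a) + h * a ≡ k * (h ∸ b) + k * b
    hk-split′ a b a<k b≤h = trans (shift h (k ∸ suc a) a) (hk-split a b a<k b≤h)
      where shift : ∀ h x y → h * suc x + h * y ≡ h * x + h * suc y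
            shift = solve-∀

    block⇒interval : ∀ a b → a < k → b < h → a ≡ block b → lo a ≤ b × b < hi a
    block⇒interval a b a<k b<h a≡block = lo≤b , b<hi
      where
      f≡ : f b ≡ k ∸ suc a
      f≡ = trans (sym (k∸[k∸1+a] (f b) (f<k b b<h))) (cong (λ z → k ∸ suc z) (sym a≡block))
      lower : h * (k ∸ suc a) ≤ k * b
      lower = begin
        h * (k ∸ suc a)  ≡⟨ trans (cong (h *_) (sym f≡)) (*-comm h (f b)) ⟩
        f b * h          ≤⟨ m≤n+m (f b * h) (s b) ⟩
        s b + f b * h    ≡⟨ k*b≡ b ⟨
        k * b            ∎
        where open ≤-Reasoning
      upper : k * b < h * suc (k ∸ suc a)
      upper = begin-strict
        k * b                ≡⟨ k*b≡ b ⟩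
        s b + f b * h        <⟨ +-monoˡ-< (f b * h) (m%n<n (k * b) h) ⟩
        h + f b * h          ≡⟨ cong (λ z → h + z * h) f≡ ⟩
        h + (k ∸ suc a) * h  ≡⟨ trans (cong (h +_) (*-comm (k ∸ suc a) h)) (sym (*-suc h (k ∸ suc a))) ⟩
        h * suc (k ∸ suc a)  ∎
        where open ≤-Reasoning
      lo≤b : lo a ≤ b
      lo≤b = ∸-swap-≤ h b (q (suc a)) (*≤⇒≤/ (h * suc a) (h ∸ b) k
        (swap-≤ (h * (k ∸ suc a)) (h * suc a) (k * (h ∸ b)) (k * b) (hk-split a b a<k (<⇒≤ b<h)) lower))
      b<hi : b < hi a
      b<hi = ∸-swap-< h b (q a) (<*⇒/< (h * a) (h ∸ b) k
        (swap-< (h * suc (k ∸ suc a)) (h * a) (k * (h ∸ b)) (k * b) (hk-split′ a b a<k (<⇒≤ b<h)) upper))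

    lo≤⇒bound : ∀ a b → lo a ≤ b → k * (h ∸ b) ≤ h * suc a
    lo≤⇒bound a b lo≤b = ≤/⇒*≤ (h * suc a) (h ∸ b) k (∸-swap-≤ h (q (suc a)) b lo≤b)

    interval⇒block : ∀ a b → a < k → b < h → lo a ≤ b × b < hi a → a ≡ block b
    interval⇒block a b a<k b<h (lo≤b , b<hi) =
      trans (sym (k∸[k∸1+a] a a<k)) (cong (λ z → k ∸ suc z) (sym f≡))
      where
      lower : h * (k ∸ suc a) ≤ k * b
      lower = swap-≤ (k * (h ∸ b)) (k * b) (h * (k ∸ suc a)) (h * suc a)
                (sym (hk-split a b a<k (<⇒≤ b<h))) (lo≤⇒bound a b lo≤b)
      upper : k * b < h * suc (k ∸ suc a)
      upper = swap-< (k * (h ∸ b)) (k * b) (h * suc (k ∸ suc a)) (h * a)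
                (sym (hk-split′ a b a<k (<⇒≤ b<h))) (/<⇒<* (h * a) (h ∸ b) k (∸-swap-< h (q a) b b<hi))
      f≡ : f b ≡ k ∸ suc a
      f≡ = ≤-antisym (≤-pred (<*⇒/< (k * b) (suc (k ∸ suc a)) h upper)) (*≤⇒≤/ (k * b) (k ∸ suc a) h lower)

    exponent-step : ∀ a b → b < h → k * (h ∸ b) ≤ h * suc a → e a (suc b) ≡ e a b + k
    exponent-step a b b<h bound = ∸-intro (begin
      h * suc a                                ≡⟨ m∸n+n≡m bound ⟨
      e a b + k * (h ∸ b)                      ≡⟨ cong (λ z → e a b + k * z) h∸b ⟩
      e a b + k * suc (h ∸ suc b)              ≡⟨ cong (e a b +_) (*-suc k (h ∸ suc b)) ⟩
      e a b + (k + k * (h ∸ suc b))            ≡⟨ +-assoc (e a b) k _ ⟨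
      e a b + k + k * (h ∸ suc b)              ∎)
      where
      open ≡-Reasoning
      h∸b : h ∸ b ≡ suc (h ∸ suc b)
      h∸b = ∸-intro (trans (sym (m∸n+n≡m b<h)) (+-suc (h ∸ suc b) b))

    exponent-at-hi : ∀ a → a < k → e a (hi a) ≡ r a + h
    exponent-at-hi a a<k = trans (cong (λ z → h * suc a ∸ k * z) (m∸[m∸n]≡n (q≤h a (<⇒≤ a<k))))
      (∸-intro (begin
        h * suc a            ≡⟨ *-suc h a ⟩
        h + h * a            ≡⟨ cong (h +_) (h*a≡ a) ⟩
        h + (r a + q a * k)  ≡⟨ +-assoc h (r a) _ ⟨
        h + r a + q a * k    ≡⟨ cong₂ _+_ (+-comm h (r a)) (*-comm (q a) k) ⟩
        r a + h + k * q a    ∎))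
      where open ≡-Reasoning

    exponent-at-lo : ∀ a → a < k → e a (lo a) ≡ r (suc a)
    exponent-at-lo a a<k = trans (cong (λ z → h * suc a ∸ k * z) (m∸[m∸n]≡n (q≤h (suc a) a<k)))
      (∸-intro (trans (h*a≡ (suc a)) (cong (r (suc a) +_) (*-comm (q (suc a)) k))))

    exponent-at-block : ∀ b → b < h → e (block b) b ≡ s b
    exponent-at-block b b<h = ∸-intro (+-cancelʳ-≡ (f b * h) _ _ (begin
      h * suc (block b) + f b * h      ≡⟨ rearrange h (block b) (f b) ⟩
      (suc (block b) + f b) * h        ≡⟨ cong (_* h) (block+f b b<h) ⟩
      k * h                            ≡⟨ cong (k *_) (m∸n+n≡m (<⇒≤ b<h)) ⟨
      k * ((h ∸ b) + b)                ≡⟨ *-distribˡ-+ k (h ∸ b) b ⟩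
      k * (h ∸ b) + k * b              ≡⟨ cong (k * (h ∸ b) +_) (k*b≡ b) ⟩
      k * (h ∸ b) + (s b + f b * h)    ≡⟨ rearrange′ (k * (h ∸ b)) (s b) (f b * h) ⟩
      s b + k * (h ∸ b) + f b * h      ∎))
      where
      open ≡-Reasoning
      rearrange : ∀ h x y → h * suc x + y * h ≡ (suc x + y) * h
      rearrange = solve-∀
      rearrange′ : ∀ x y z → x + (y + z) ≡ y + x + z
      rearrange′ = solve-∀

    -- h · block b = hk + s b - kb - h, in additive form
    block-identity : ∀ b → b < h → h * block b + k * b + h ≡ h * k + s b
    block-identity b b<h = begin
      h * block b + k * b + h            ≡⟨ cong (λ z → h * block b + z + h) (k*b≡ b) ⟩
      h * block b + (s b + f b * h) + h  ≡⟨ rearrange h (block b) (s b) (f b) ⟩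
      h * (suc (block b) + f b) + s b    ≡⟨ cong (λ z → h * z + s b) (block+f b b<h) ⟩
      h * k + s b                        ∎
      where
      open ≡-Reasoning
      rearrange : ∀ h x s y → h * x + (s + y * h) + h ≡ h * (suc x + y) + s
      rearrange = solve-∀

module PolynomialReciprocity {c ℓ} (R : CommutativeRing c ℓ) (y : CommutativeRing.Carrier R) where
  open import Data.Nat as ℕ using (ℕ; zero; suc; _<_; NonZero)
  import Data.Nat.Properties as ℕ
  open import Data.Nat.GCD using (gcd; gcd-comm)
  open import Data.Integer using (+_)
  open import Data.Empty using (⊥-elim)
  open import Data.Product using (_×_; _,_)
  open import Relation.Nullary using (yes; no; ¬_)
  open import Relation.Binary.PropositionalEquality as ≡ using (_≡_)

  open FiniteSums R

  geo : ℕ → Carrier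
  geo n = Σ n (λ i → y ^ i)

  geometric-sum : ∀ n → (y - 1#) * geo n ≈ y ^ n - 1#
  geometric-sum zero = trans (zeroʳ _) (sym (-‿inverseʳ 1#))
  geometric-sum (suc n) = begin
    (y - 1#) * (geo n + y ^ n)            ≈⟨ distribˡ _ _ _ ⟩
    (y - 1#) * geo n + (y - 1#) * y ^ n   ≈⟨ +-congʳ (geometric-sum n) ⟩
    (y ^ n - 1#) + (y - 1#) * y ^ n
      ≈⟨ solve 2 (λ Y P → (P :- con (+ 1)) :+ (Y :- con (+ 1)) :* P := Y :* P :- con (+ 1)) refl y (y ^ n) ⟩
    y * y ^ n - 1#                        ∎

  weighted : ℕ → Carrier
  weighted n = Σ n (λ t → ν t * y ^ t)

  weighted-geometric-sum : ∀ n → (y - 1#) * weighted n ≈ ν n * y ^ n - y * geo n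
  weighted-geometric-sum zero =
    trans (zeroʳ _) (solve 1 (λ Y → con (+ 0) := con (+ 0) :* con (+ 1) :- Y :* con (+ 0)) refl y)
  weighted-geometric-sum (suc n) = begin
    (y - 1#) * (weighted n + ν n * y ^ n)                  ≈⟨ distribˡ _ _ _ ⟩
    (y - 1#) * weighted n + (y - 1#) * (ν n * y ^ n)       ≈⟨ +-congʳ (weighted-geometric-sum n) ⟩
    (ν n * y ^ n - y * geo n) + (y - 1#) * (ν n * y ^ n)
      ≈⟨ solve 4 (λ Y P G N → (N :* P :- Y :* G) :+ (Y :- con (+ 1)) :* (N :* P)
                            := (con (+ 1) :+ N) :* (Y :* P) :- Y :* (G :+ P)) refl y (y ^ n) (geo n) (ν n) ⟩
    (1# + ν n) * (y * y ^ n) - y * (geo n + y ^ n)        ≈⟨ +-congʳ (*-congʳ (ν-suc n)) ⟨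
    ν (suc n) * (y * y ^ n) - y * (geo n + y ^ n)         ∎

  move : ∀ {a b c} → a + b ≈ c → a ≈ c - b
  move {a} {b} e = trans (solve 2 (λ A B → A := (A :+ B) :- B) refl a b) (+-congʳ e)

  cancelʳ : ∀ {a b c} → a + c ≈ b + c → a ≈ b
  cancelʳ {b = b} {c} e = trans (move e) (solve 2 (λ B C → (B :+ C) :- C := B) refl b c)

  module _ (h k : ℕ) {{_ : NonZero h}} {{_ : NonZero k}} (coprime : gcd h k ≡ 1) where
    open FloorArithmetic
    open Blocks h k
    module ×h = ResiduePermutation h k coprime
    module ×k = ResiduePermutation k h (≡.trans (gcd-comm k h) coprime)

    Σ-residues-k : ∀ (G : ℕ → Carrier) → Σ k (λ a → G (r a)) ≈ Σ k G
    Σ-residues-k G = Σ-permute k ×h.φ ×h.ψ G ×h.φ< ×h.ψ< ×h.φψ ×h.ψφ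

    Σ-residues-h : ∀ (G : ℕ → Carrier) → Σ h (λ b → G (s b)) ≈ Σ h G
    Σ-residues-h G = Σ-permute h ×k.φ ×k.ψ G ×k.φ< ×k.ψ< ×k.φψ ×k.ψφ

    Pk Ph : Carrier
    Pk = Σ k (λ a → ν a * y ^ r a)
    Ph = Σ h (λ b → ν b * y ^ s b)

    blockSum : ℕ → Carrier
    blockSum a = Σ h (λ b → [ a ℕ.≟ block b ]· (y ^ e a b))

    weightedBlocks : Carrier
    weightedBlocks = Σ k (λ a → ν a * blockSum a)

    block-telescope : ∀ a → a < k → (y ^ k - 1#) * blockSum a ≈ y ^ (r a ℕ.+ h) - y ^ r (suc a)
    block-telescope a a<k = begin
      (y ^ k - 1#) * blockSum a                                  ≈⟨ Σ-*ˡ h _ _ ⟩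
      Σ h (λ b → (y ^ k - 1#) * [ a ℕ.≟ block b ]· (y ^ e a b))  ≈⟨ Σ-cong h step≈ ⟩
      Σ h T.step                                                 ≈⟨ T.telescope h (hi≤h a) ⟩
      y ^ e a (hi a) - y ^ e a (lo a)
        ≈⟨ +-cong (^-congʳ y (exponent-at-hi a a<k)) (-‿cong (^-congʳ y (exponent-at-lo a a<k))) ⟩
      y ^ (r a ℕ.+ h) - y ^ r (suc a)                            ∎
      where
      module T = Telescope (λ b → y ^ e a b) (lo a) (hi a) (lo≤hi a)
      in-block : ∀ b → b < h → lo a ℕ.≤ b × b < hi a → T.step b ≈ (y ^ k - 1#) * y ^ e a b
      in-block b b<h (lo≤b , b<hi) = begin
        T.step b                                       ≈⟨ [yes]· (lo a ℕ.≤? b) lo≤b _ ⟩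
        [ b ℕ.<? hi a ]· (y ^ e a (suc b) - y ^ e a b) ≈⟨ [yes]· (b ℕ.<? hi a) b<hi _ ⟩
        y ^ e a (suc b) - y ^ e a b
          ≈⟨ +-congʳ (trans (^-congʳ y (≡.trans (exponent-step a b b<h (lo≤⇒bound a b lo≤b)) (ℕ.+-comm (e a b) k)))
                            (^-homo-* y k (e a b))) ⟩
        y ^ k * y ^ e a b - y ^ e a b
          ≈⟨ solve 2 (λ K E → K :* E :- E := (K :- con (+ 1)) :* E) refl (y ^ k) (y ^ e a b) ⟩
        (y ^ k - 1#) * y ^ e a b                       ∎

      off-block : ∀ b → b < h → ¬ (a ≡ block b) → T.step b ≈ 0#
      off-block b b<h a≢block with lo a ℕ.≤? b | b ℕ.<? hi a
      ... | yes lo≤b | yes b<hi = ⊥-elim (a≢block (interval⇒block a b a<k b<h (lo≤b , b<hi)))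
      ... | yes _    | no _     = refl
      ... | no _     | _        = refl

      step≈ : ∀ b → b < h → (y ^ k - 1#) * [ a ℕ.≟ block b ]· (y ^ e a b) ≈ T.step b
      step≈ b b<h with a ℕ.≟ block b
      ... | yes a≡block = sym (in-block b b<h (block⇒interval a b a<k b<h a≡block))
      ... | no  a≢block = trans (zeroʳ _) (sym (off-block b b<h a≢block))

    split-Pk : (y ^ h - 1#) * Pk ≈ Σ k (λ a → ν a * (y ^ r (suc a) - y ^ r a))
                                  + Σ k (λ a → ν a * (y ^ (r a ℕ.+ h) - y ^ r (suc a)))
    split-Pk = begin
      (y ^ h - 1#) * Pk                         ≈⟨ Σ-*ˡ k _ _ ⟩
      Σ k (λ a → (y ^ h - 1#) * (ν a * y ^ r a)) ≈⟨ Σ-cong′ k term ⟩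
      Σ k (λ a → ν a * (y ^ r (suc a) - y ^ r a) + ν a * (y ^ (r a ℕ.+ h) - y ^ r (suc a))) ≈⟨ Σ-+ k _ _ ⟩
      _ ∎
      where
      term : ∀ a → (y ^ h - 1#) * (ν a * y ^ r a)
                   ≈ ν a * (y ^ r (suc a) - y ^ r a) + ν a * (y ^ (r a ℕ.+ h) - y ^ r (suc a))
      term a = trans (solve 4 (λ Yh N P Q → (Yh :- con (+ 1)) :* (N :* P) := N :* (Q :- P) :+ N :* (P :* Yh :- Q))
                              refl (y ^ h) (ν a) (y ^ r a) (y ^ r (suc a)))
                     (+-congˡ (*-congˡ (+-congʳ (sym (^-homo-* y (r a) h)))))

    -- by parts, and since a ↦ r a permutes {0,…,k-1} with r 0 = r k = 0
    residue-part : Σ k (λ a → ν a * (y ^ r (suc a) - y ^ r a)) ≈ ν k - geo k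
    residue-part = begin
      Σ k (λ a → ν a * (F (suc a) - F a)) ≈⟨ move (Σ-by-parts k F) ⟩
      ν k * F k - Σ k (λ a → F (suc a))    ≈⟨ +-cong (trans (*-congˡ (^-congʳ y r-k)) (*-identityʳ _)) (-‿cong shifted) ⟩
      ν k - Σ k F                          ≈⟨ +-congˡ (-‿cong (Σ-residues-k (λ t → y ^ t))) ⟩
      ν k - geo k                          ∎
      where
      F : ℕ → Carrier
      F a = y ^ r a
      shifted : Σ k (λ a → F (suc a)) ≈ Σ k F
      shifted = cancelʳ (trans (Σ-shift k F) (+-congˡ (trans (^-congʳ y r-k) (sym (^-congʳ y r-zero)))))

    block-part : Σ k (λ a → ν a * (y ^ (r a ℕ.+ h) - y ^ r (suc a))) ≈ (y ^ k - 1#) * weightedBlocks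
    block-part = begin
      Σ k (λ a → ν a * (y ^ (r a ℕ.+ h) - y ^ r (suc a))) ≈⟨ Σ-cong k (λ a a<k → *-congˡ (sym (block-telescope a a<k))) ⟩
      Σ k (λ a → ν a * ((y ^ k - 1#) * blockSum a))       ≈⟨ Σ-cong′ k (λ a → x∙yz≈y∙xz _ _ _) ⟩
      Σ k (λ a → (y ^ k - 1#) * (ν a * blockSum a))       ≈⟨ Σ-*ˡ k _ _ ⟨
      (y ^ k - 1#) * weightedBlocks                       ∎
      where open import Algebra.Properties.CommutativeSemigroup *-commutativeSemigroup using (x∙yz≈y∙xz)

    -- counting the blocks from the side of b:  Σ_a a I_a = Σ_b (block b) y^{s b}
    weightedBlocks-by-b : weightedBlocks ≈ Σ h (λ b → ν (block b) * y ^ s b)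
    weightedBlocks-by-b = begin
      weightedBlocks
        ≈⟨ Σ-cong′ k (λ a → trans (Σ-*ˡ h _ _) (Σ-cong′ h (λ b → *-[]· (a ℕ.≟ block b) (ν a) _))) ⟩
      Σ k (λ a → Σ h (λ b → [ a ℕ.≟ block b ]· (ν a * y ^ e a b))) ≈⟨ Σ-swap k h _ ⟩
      Σ h (λ b → Σ k (λ a → [ a ℕ.≟ block b ]· (ν a * y ^ e a b)))
        ≈⟨ Σ-cong h (λ b b<h → Σ-delta k (block b) (λ a → ν a * y ^ e a b) (block<k b b<h)) ⟩
      Σ h (λ b → ν (block b) * y ^ e (block b) b) ≈⟨ Σ-cong h (λ b b<h → *-congˡ (^-congʳ y (exponent-at-block b b<h))) ⟩
      Σ h (λ b → ν (block b) * y ^ s b)           ∎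

    ν-block : ∀ b → b < h → ν h * ν (block b) ≈ ν h * ν k + ν (s b) - ν k * ν b - ν h
    ν-block b b<h = trans (move (move additive))
      (solve 4 (λ A B C D → A :+ B :- D :- C := A :+ B :- C :- D) refl (ν h * ν k) (ν (s b)) (ν k * ν b) (ν h))
      where
      additive : ν h * ν (block b) + ν k * ν b + ν h ≈ ν h * ν k + ν (s b)
      additive = begin
        ν h * ν (block b) + ν k * ν b + ν h        ≈⟨ +-congʳ (+-cong (ν-* h (block b)) (ν-* k b)) ⟨
        ν (h ℕ.* block b) + ν (k ℕ.* b) + ν h      ≈⟨ +-congʳ (ν-+ (h ℕ.* block b) (k ℕ.* b)) ⟨
        ν (h ℕ.* block b ℕ.+ k ℕ.* b) + ν h        ≈⟨ ν-+ (h ℕ.* block b ℕ.+ k ℕ.* b) h ⟨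
        ν (h ℕ.* block b ℕ.+ k ℕ.* b ℕ.+ h)        ≈⟨ reflexive (≡.cong ν (block-identity b b<h)) ⟩
        ν (h ℕ.* k ℕ.+ s b)                        ≈⟨ ν-+ (h ℕ.* k) (s b) ⟩
        ν (h ℕ.* k) + ν (s b)                      ≈⟨ +-congʳ (ν-* h k) ⟩
        ν h * ν k + ν (s b)                        ∎

    h·weightedBlocks : ν h * weightedBlocks ≈ ν h * ν k * geo h + weighted h - ν k * Ph - ν h * geo h
    h·weightedBlocks = begin
      ν h * weightedBlocks                          ≈⟨ *-congˡ weightedBlocks-by-b ⟩
      ν h * Σ h (λ b → ν (block b) * y ^ s b)       ≈⟨ Σ-*ˡ h _ _ ⟩
      Σ h (λ b → ν h * (ν (block b) * y ^ s b))
        ≈⟨ Σ-cong h (λ b b<h → trans (sym (*-assoc _ _ _)) (trans (*-congʳ (ν-block b b<h))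
             (solve 6 (λ A S K B H Y → (A :+ S :- K :* B :- H) :* Y := A :* Y :+ S :* Y :+ (:- K) :* (B :* Y) :+ (:- H) :* Y)
                      refl (ν h * ν k) (ν (s b)) (ν k) (ν b) (ν h) (y ^ s b)))) ⟩
      Σ h (λ b → ν h * ν k * y ^ s b + ν (s b) * y ^ s b + - ν k * (ν b * y ^ s b) + - ν h * y ^ s b)
        ≈⟨ trans (Σ-+ h _ _) (+-cong (trans (Σ-+ h _ _) (+-cong (trans (Σ-+ h _ _) (+-congʳ (sym (Σ-*ˡ h _ _))))
                                                           (sym (Σ-*ˡ h _ _))))
                                    (sym (Σ-*ˡ h _ _))) ⟩
      ν h * ν k * Σ h (λ b → y ^ s b) + Σ h (λ b → ν (s b) * y ^ s b) + - ν k * Ph + - ν h * Σ h (λ b → y ^ s b)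
        ≈⟨ +-cong (+-congʳ (+-cong (*-congˡ (Σ-residues-h (y ^_))) (Σ-residues-h (λ t → ν t * y ^ t))))
                  (*-congˡ (Σ-residues-h (y ^_))) ⟩
      ν h * ν k * geo h + weighted h + - ν k * Ph + - ν h * geo h
        ≈⟨ solve 6 (λ A G N K P H → A :* G :+ N :+ (:- K) :* P :+ (:- H) :* G := A :* G :+ N :- K :* P :- H :* G)
                   refl (ν h * ν k) (geo h) (weighted h) (ν k) Ph (ν h) ⟩
      ν h * ν k * geo h + weighted h - ν k * Ph - ν h * geo h ∎

    weighted-correction : (y ^ k - 1#) * (weighted h - ν h * geo h) ≈ ν h * geo k - y * geo k * geo h
    weighted-correction = begin
      (y ^ k - 1#) * (weighted h - ν h * geo h)       ≈⟨ *-congʳ (geometric-sum k) ⟨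
      ((y - 1#) * geo k) * (weighted h - ν h * geo h)
        ≈⟨ solve 5 (λ Y G N H Gh → ((Y :- con (+ 1)) :* G) :* (N :- H :* Gh)
                                 := G :* ((Y :- con (+ 1)) :* N :- H :* ((Y :- con (+ 1)) :* Gh)))
                   refl y (geo k) (weighted h) (ν h) (geo h) ⟩
      geo k * ((y - 1#) * weighted h - ν h * ((y - 1#) * geo h))
        ≈⟨ *-congˡ (+-cong (weighted-geometric-sum h) (-‿cong (*-congˡ (geometric-sum h)))) ⟩
      geo k * ((ν h * y ^ h - y * geo h) - ν h * (y ^ h - 1#))
        ≈⟨ solve 5 (λ G H Yh Y Gh → G :* ((H :* Yh :- Y :* Gh) :- H :* (Yh :- con (+ 1))) := H :* G :- Y :* G :* Gh)
                   refl (geo k) (ν h) (y ^ h) y (geo h) ⟩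
      ν h * geo k - y * geo k * geo h                ∎

    reciprocity : ν h * ((y ^ h - 1#) * Pk) + ν k * ((y ^ k - 1#) * Ph)
                  ≈ ν h * ν k - y * geo k * geo h + ν h * ν k * ((y ^ k - 1#) * geo h)
    reciprocity = begin
      ν h * ((y ^ h - 1#) * Pk) + ν k * ((y ^ k - 1#) * Ph)
        ≈⟨ +-congʳ (*-congˡ (trans split-Pk (+-cong residue-part block-part))) ⟩
      ν h * ((ν k - geo k) + (y ^ k - 1#) * weightedBlocks) + ν k * ((y ^ k - 1#) * Ph)
        ≈⟨ solve 6 (λ H K G E W P → H :* ((K :- G) :+ E :* W) :+ K :* (E :* P)
                                 := H :* K :- H :* G :+ E :* (H :* W) :+ K :* (E :* P))
                   refl (ν h) (ν k) (geo k) (y ^ k - 1#) weightedBlocks Ph ⟩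
      ν h * ν k - ν h * geo k + (y ^ k - 1#) * (ν h * weightedBlocks) + ν k * ((y ^ k - 1#) * Ph)
        ≈⟨ +-congʳ (+-congˡ (*-congˡ h·weightedBlocks)) ⟩
      ν h * ν k - ν h * geo k + (y ^ k - 1#) * (ν h * ν k * geo h + weighted h - ν k * Ph - ν h * geo h)
        + ν k * ((y ^ k - 1#) * Ph)
        ≈⟨ solve 7 (λ H K G E Gh N P → H :* K :- H :* G :+ E :* (H :* K :* Gh :+ N :- K :* P :- H :* Gh) :+ K :* (E :* P)
                                    := H :* K :- H :* G :+ H :* K :* (E :* Gh) :+ E :* (N :- H :* Gh))
                   refl (ν h) (ν k) (geo k) (y ^ k - 1#) (geo h) (weighted h) Ph ⟩
      ν h * ν k - ν h * geo k + ν h * ν k * ((y ^ k - 1#) * geo h) + (y ^ k - 1#) * (weighted h - ν h * geo h)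
        ≈⟨ +-congˡ weighted-correction ⟩
      ν h * ν k - ν h * geo k + ν h * ν k * ((y ^ k - 1#) * geo h) + (ν h * geo k - y * geo k * geo h)
        ≈⟨ solve 6 (λ H K G X Y Gh → H :* K :- H :* G :+ X :+ (H :* G :- Y :* G :* Gh) := H :* K :- Y :* G :* Gh :+ X)
                   refl (ν h) (ν k) (geo k) (ν h * ν k * ((y ^ k - 1#) * geo h)) y (geo h) ⟩
      ν h * ν k - y * geo k * geo h + ν h * ν k * ((y ^ k - 1#) * geo h) ∎

-- Sequences A : ℕ → R, viewed as
-- Σ A n tⁿ/n!, form a commutative ring under pointwise addition and the
-- binomial convolution (A ⊛ B) n = Σ_{j≤n} C(n,j) A j B (n-j); the shift
-- D A n = A (n+1) is the derivative and obeys the Leibniz rule.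
module ExponentialSeries {c ℓ} (R : CommutativeRing c ℓ) where
  open import Algebra.Structures using (IsCommutativeRing)
  open import Data.Nat as ℕ using (ℕ; zero; suc; _∸_)
  import Data.Nat.Properties as ℕ
  open import Data.Nat.Combinatorics using (_C_; nCk+nC[k+1]≡[n+1]C[k+1]; k>n⇒nCk≡0)
  open import Data.Integer using (+_)
  open import Data.Product using (_,_)
  import Relation.Binary.PropositionalEquality as ≡

  open FiniteSums R

  Series : Set c
  Series = ℕ → Carrier

  infix  4 _≋_
  infixl 6 _⊕_
  infixl 7 _⊛_

  _≋_ : Series → Series → Set ℓ
  A ≋ B = ∀ n → A n ≈ B n

  _⊕_ _⊛_ : Series → Series → Series
  (A ⊕ B) n = A n + B n
  (A ⊛ B) n = Σ (suc n) (λ j → ν (n C j) * A j * B (n ∸ j))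

  ⊝_ : Series → Series
  (⊝ A) n = - A n

  κ : Carrier → Series
  κ x zero    = x
  κ x (suc n) = 0#

  𝟘 𝟙 : Series
  𝟘 n = 0#
  𝟙 = κ 1#

  D : Series → Series
  D A n = A (suc n)

  ⊛-cong : ∀ {A A′ B B′} → A ≋ A′ → B ≋ B′ → A ⊛ B ≋ A′ ⊛ B′
  ⊛-cong A≋ B≋ n = Σ-cong′ (suc n) (λ j → *-cong (*-congˡ (A≋ j)) (B≋ (n ∸ j)))

  ⊛-zero : ∀ A B → (A ⊛ B) 0 ≈ A 0 * B 0
  ⊛-zero A B = trans (+-identityˡ _) (*-congʳ (*-identityˡ (A 0)))

  ν-pascal : ∀ n j → ν (suc n C suc j) ≈ ν (n C j) + ν (n C suc j)
  ν-pascal n j = trans (reflexive (≡.cong ν (≡.sym (nCk+nC[k+1]≡[n+1]C[k+1] n j)))) (ν-+ (n C j) (n C suc j))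

  -- Leibniz rule  D (A ⊛ B) = D A ⊛ B + A ⊛ D B, from Pascal's rule
  leibniz : ∀ A B n → (A ⊛ B) (suc n) ≈ (D A ⊛ B) n + (A ⊛ D B) n
  leibniz A B n = begin
    (A ⊛ B) (suc n)                                              ≈⟨ Σ-first (suc n) _ ⟩
    1# * A 0 * B (suc n) + Σ (suc n) (λ j → ν (suc n C suc j) * A (suc j) * B (n ∸ j))
      ≈⟨ +-congˡ (Σ-cong′ (suc n) (λ j → trans (*-congʳ (*-congʳ (ν-pascal n j)))
                                                          (trans (*-congʳ (distribʳ _ _ _)) (distribʳ _ _ _)))) ⟩
    1# * A 0 * B (suc n) + Σ (suc n) (λ j → ν (n C j) * A (suc j) * B (n ∸ j) + ν (n C suc j) * A (suc j) * B (n ∸ j))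
      ≈⟨ +-congˡ (Σ-+ (suc n) _ _) ⟩
    1# * A 0 * B (suc n) + ((D A ⊛ B) n + Σ (suc n) (λ j → ν (n C suc j) * A (suc j) * B (n ∸ j)))
      ≈⟨ x∙yz≈y∙xz _ _ _ ⟩
    (D A ⊛ B) n + (1# * A 0 * B (suc n) + Σ (suc n) (λ j → ν (n C suc j) * A (suc j) * B (n ∸ j)))
      ≈⟨ +-congˡ (+-congˡ last-term) ⟩
    (D A ⊛ B) n + (ν (n C 0) * A 0 * D B (n ∸ 0) + Σ n (λ j → ν (n C suc j) * A (suc j) * D B (n ∸ suc j)))
      ≈⟨ +-congˡ (Σ-first n _) ⟨
    (D A ⊛ B) n + (A ⊛ D B) n                                    ∎
    where
    open import Algebra.Properties.CommutativeSemigroup +-commutativeSemigroup using (x∙yz≈y∙xz)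
    -- the j = n term vanishes since C(n, n+1) = 0; the others are reindexed
    last-term : Σ (suc n) (λ j → ν (n C suc j) * A (suc j) * B (n ∸ j))
                ≈ Σ n (λ j → ν (n C suc j) * A (suc j) * D B (n ∸ suc j))
    last-term = begin
      Σ n (λ j → ν (n C suc j) * A (suc j) * B (n ∸ j)) + ν (n C suc n) * A (suc n) * B (n ∸ n)
        ≈⟨ +-cong (Σ-cong n (λ j j<n → *-congˡ (reflexive (≡.cong B (ℕ.+-∸-assoc 1 j<n)))))
                  (trans (*-congʳ (*-congʳ (reflexive (≡.cong ν (k>n⇒nCk≡0 (ℕ.n<1+n n))))))
                         (trans (*-congʳ (zeroˡ _)) (zeroˡ _))) ⟩
      Σ n (λ j → ν (n C suc j) * A (suc j) * D B (n ∸ suc j)) + 0#  ≈⟨ +-identityʳ _ ⟩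
      Σ n (λ j → ν (n C suc j) * A (suc j) * D B (n ∸ suc j))       ∎

  ⊛-comm : ∀ A B → A ⊛ B ≋ B ⊛ A
  ⊛-comm A B zero    = trans (⊛-zero A B) (trans (*-comm _ _) (sym (⊛-zero B A)))
  ⊛-comm A B (suc n) = begin
    (A ⊛ B) (suc n)            ≈⟨ leibniz A B n ⟩
    (D A ⊛ B) n + (A ⊛ D B) n  ≈⟨ +-cong (⊛-comm (D A) B n) (⊛-comm A (D B) n) ⟩
    (B ⊛ D A) n + (D B ⊛ A) n  ≈⟨ +-comm _ _ ⟩
    (D B ⊛ A) n + (B ⊛ D A) n  ≈⟨ leibniz B A n ⟨
    (B ⊛ A) (suc n)            ∎

  ⊛-distribˡ : ∀ A B Z → A ⊛ (B ⊕ Z) ≋ A ⊛ B ⊕ A ⊛ Z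
  ⊛-distribˡ A B Z n = trans (Σ-cong′ (suc n) (λ j → distribˡ _ _ _)) (Σ-+ (suc n) _ _)

  ⊛-distribʳ : ∀ A B Z → (B ⊕ Z) ⊛ A ≋ B ⊛ A ⊕ Z ⊛ A
  ⊛-distribʳ A B Z n =
    trans (Σ-cong′ (suc n) (λ j → trans (*-congʳ (distribˡ _ _ _)) (distribʳ _ _ _))) (Σ-+ (suc n) _ _)

  -- associativity, by induction on the coefficient index via Leibniz
  ⊛-assoc : ∀ A B Z → (A ⊛ B) ⊛ Z ≋ A ⊛ (B ⊛ Z)
  ⊛-assoc A B Z zero = begin
    ((A ⊛ B) ⊛ Z) 0    ≈⟨ trans (⊛-zero (A ⊛ B) Z) (*-congʳ (⊛-zero A B)) ⟩
    A 0 * B 0 * Z 0    ≈⟨ *-assoc _ _ _ ⟩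
    A 0 * (B 0 * Z 0)  ≈⟨ trans (*-congˡ (sym (⊛-zero B Z))) (sym (⊛-zero A (B ⊛ Z))) ⟩
    (A ⊛ (B ⊛ Z)) 0    ∎
  ⊛-assoc A B Z (suc n) = begin
    ((A ⊛ B) ⊛ Z) (suc n)                                       ≈⟨ leibniz (A ⊛ B) Z n ⟩
    (D (A ⊛ B) ⊛ Z) n + ((A ⊛ B) ⊛ D Z) n
      ≈⟨ +-congʳ (trans (⊛-cong {B = Z} (leibniz A B) (λ _ → refl) n) (⊛-distribʳ Z (D A ⊛ B) (A ⊛ D B) n)) ⟩
    ((D A ⊛ B) ⊛ Z) n + ((A ⊛ D B) ⊛ Z) n + ((A ⊛ B) ⊛ D Z) n
      ≈⟨ +-cong (+-cong (⊛-assoc (D A) B Z n) (⊛-assoc A (D B) Z n)) (⊛-assoc A B (D Z) n) ⟩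
    (D A ⊛ (B ⊛ Z)) n + (A ⊛ (D B ⊛ Z)) n + (A ⊛ (B ⊛ D Z)) n
      ≈⟨ trans (+-assoc _ _ _) (+-congˡ (sym (⊛-distribˡ A (D B ⊛ Z) (B ⊛ D Z) n))) ⟩
    (D A ⊛ (B ⊛ Z)) n + (A ⊛ (D B ⊛ Z ⊕ B ⊛ D Z)) n
      ≈⟨ +-congˡ (⊛-cong {A = A} (λ _ → refl) (λ m → sym (leibniz B Z m)) n) ⟩
    (D A ⊛ (B ⊛ Z)) n + (A ⊛ D (B ⊛ Z)) n                        ≈⟨ leibniz A (B ⊛ Z) n ⟨
    (A ⊛ (B ⊛ Z)) (suc n)                                       ∎

  κ-⊛ : ∀ x A n → (κ x ⊛ A) n ≈ x * A n
  κ-⊛ x A n = begin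
    (κ x ⊛ A) n    ≈⟨ Σ-first n _ ⟩
    ν (n C 0) * x * A (n ∸ 0) + Σ n (λ j → ν (n C suc j) * 0# * A (n ∸ suc j))
      ≈⟨ +-cong (*-congʳ (*-identityˡ x))
                (Σ-zero n (λ j _ → trans (*-congʳ (zeroʳ _)) (zeroˡ _))) ⟩
    x * A n + 0#   ≈⟨ +-identityʳ _ ⟩
    x * A n        ∎

  series-isCommutativeRing : IsCommutativeRing _≋_ _⊕_ _⊛_ ⊝_ 𝟘 𝟙
  series-isCommutativeRing = record
    { isRing = record
      { +-isAbelianGroup = record
        { isGroup = record
          { isMonoid = record
            { isSemigroup = record
              { isMagma = record
                { isEquivalence = record
                  { refl = λ n → refl ; sym = λ A≋B n → sym (A≋B n) ; trans = λ A≋B B≋C n → trans (A≋B n) (B≋C n) }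
                ; ∙-cong = λ A≋ B≋ n → +-cong (A≋ n) (B≋ n) }
              ; assoc = λ A B C n → +-assoc _ _ _ }
            ; identity = (λ A n → +-identityˡ _) , (λ A n → +-identityʳ _) }
          ; inverse = (λ A n → -‿inverseˡ _) , (λ A n → -‿inverseʳ _)
          ; ⁻¹-cong = λ A≋ n → -‿cong (A≋ n) }
        ; comm = λ A B n → +-comm _ _ }
      ; *-cong = ⊛-cong
      ; *-assoc = ⊛-assoc
      ; *-identity = 𝟙-⊛ , (λ A n → trans (⊛-comm A 𝟙 n) (𝟙-⊛ A n))
      ; distrib = ⊛-distribˡ , ⊛-distribʳ }
    ; *-comm = ⊛-comm }
    where
    𝟙-⊛ : ∀ A → 𝟙 ⊛ A ≋ A
    𝟙-⊛ A n = trans (κ-⊛ 1# A n) (*-identityˡ _)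

  SeriesRing : CommutativeRing c ℓ
  SeriesRing = record { isCommutativeRing = series-isCommutativeRing }

  κ-⊛-κ : ∀ x z → κ x ⊛ κ z ≋ κ (x * z)
  κ-⊛-κ x z zero    = κ-⊛ x (κ z) zero
  κ-⊛-κ x z (suc n) = trans (κ-⊛ x (κ z) (suc n)) (zeroʳ x)

  scale-⊛ : ∀ x A B n → ((λ m → x * A m) ⊛ B) n ≈ x * (A ⊛ B) n
  scale-⊛ x A B n = sym (trans (Σ-*ˡ (suc n) x _) (Σ-cong′ (suc n) (λ j →
    solve 4 (λ X N P Q → X :* (N :* P :* Q) := N :* (X :* P) :* Q) refl x (ν (n C j)) (A j) (B (n ∸ j)))))

  -- exponential series  E x = e^{xt}:  e^{xt} e^{zt} = e^{(x+z)t}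
  E : Carrier → Series
  E x n = x ^ n

  E-⊛ : ∀ x z → E x ⊛ E z ≋ E (x + z)
  E-⊛ x z zero    = trans (⊛-zero (E x) (E z)) (*-identityˡ 1#)
  E-⊛ x z (suc n) = begin
    (E x ⊛ E z) (suc n)                      ≈⟨ leibniz (E x) (E z) n ⟩
    (D (E x) ⊛ E z) n + (E x ⊛ D (E z)) n
      ≈⟨ +-cong (scale-⊛ x (E x) (E z) n)
                (trans (⊛-comm (E x) (D (E z)) n) (trans (scale-⊛ z (E z) (E x) n) (*-congˡ (⊛-comm (E z) (E x) n)))) ⟩
    x * (E x ⊛ E z) n + z * (E x ⊛ E z) n     ≈⟨ distribʳ _ _ _ ⟨
    (x + z) * (E x ⊛ E z) n                  ≈⟨ *-congˡ (E-⊛ x z n) ⟩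
    (x + z) * (x + z) ^ n                    ∎

module SeriesInverse {c ℓ} (R : CommutativeRing c ℓ) where
  open ExponentialSeries R using (D; leibniz; SeriesRing)
  open CommutativeRing R using () renaming (trans to trans₀; sym to sym₀)
  open import Data.Nat using (suc)
  open import Data.Integer using (+_)
  open RingToolkit SeriesRing

  D-inverse : ∀ B G → B * G ≈ 1# → D G ≈ - (D B * G * G)
  D-inverse B G BG≈1 = begin
    D G                  ≈⟨ *-identityʳ (D G) ⟨
    D G * 1#             ≈⟨ *-congˡ (sym BG≈1) ⟩
    D G * (B * G)        ≈⟨ solve 3 (λ X Y Z → X :* (Y :* Z) := (Y :* X) :* Z) refl (D G) B G ⟩
    (B * D G) * G        ≈⟨ *-congʳ {G} B·DG ⟩
    (- (D B * G)) * G    ≈⟨ solve 2 (λ X Y → (:- X) :* Y := :- (X :* Y)) refl (D B * G) G ⟩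
    - (D B * G * G)      ∎
    where
    D[BG] : D B * G + B * D G ≈ 0#
    D[BG] n = trans₀ (sym₀ (leibniz B G n)) (BG≈1 (suc n))
    B·DG : B * D G ≈ - (D B * G)
    B·DG = trans (solve 2 (λ X Y → Y := (X :+ Y) :- X) refl (D B * G) (B * D G))
                 (trans (+-congʳ D[BG]) (+-identityˡ _))

module SeriesSums {c ℓ} (R : CommutativeRing c ℓ) where
  open import Data.Nat using (ℕ; zero; suc)
  open ExponentialSeries R
  open FiniteSums R
  module Series = FiniteSums SeriesRing

  Σ-coefficient : ∀ K (f : ℕ → Series) n → Series.Σ K f n ≈ Σ K (λ a → f a n)
  Σ-coefficient zero    f n = refl
  Σ-coefficient (suc K) f n = +-congʳ (Σ-coefficient K f n)

  ν-series : ∀ m → Series.ν m ≋ κ (ν m)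
  ν-series zero    zero    = refl
  ν-series zero    (suc j) = refl
  ν-series (suc m) zero    = trans (Series.ν-suc m zero) (trans (+-congˡ (ν-series m zero)) (sym (ν-suc m)))
  ν-series (suc m) (suc j) = trans (Series.ν-suc m (suc j)) (trans (+-congˡ (ν-series m (suc j))) (+-identityˡ 0#))

-- Field-level facts: the Frobenius–Euler numbers of Defs satisfy their
-- recurrence, and their exponential generating function
--   A(t) = (v/(1-v)) (1-v)/(e^{Kt} - v) = Σ (v/(1-v)) H_j(v) K^j t^j/j!
-- is the inverse of  w e^{Kt} - 1  whenever w v = 1.
module FrobeniusEuler {c ℓ} (F : Field c ℓ) where
  open import Data.Nat as ℕ using (ℕ; zero; suc; _<_; _≤_; _∸_)
  import Data.Nat.Properties as ℕ
  open import Data.Nat.Combinatorics using (_C_; nCn≡1)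
  open import Data.Integer using (+_)
  open import Data.Empty using (⊥-elim)
  open import Relation.Nullary using (¬_; yes; no)
  open import Relation.Binary.PropositionalEquality as ≡ using (_≡_)

  open Field F public using (commutativeRing; _⁻¹; ⁻¹-inverse; 0≉1)
  open FiniteSums commutativeRing public
  open ExponentialSeries commutativeRing public
  open FE F public using (fromℕ; sumTo; H; Hupto; Hpoly; Hbar; S) renaming (_^_ to _^ᶠ_)

  sumTo≈Σ : ∀ n f → sumTo n f ≈ Σ n f
  sumTo≈Σ zero    f = refl
  sumTo≈Σ (suc n) f = +-congʳ (sumTo≈Σ n f)

  fromℕ≈ν : ∀ n → fromℕ n ≈ ν n
  fromℕ≈ν zero    = refl
  fromℕ≈ν (suc n) = trans (+-congˡ (fromℕ≈ν n)) (sym (ν-suc n))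

  ^ᶠ≈^ : ∀ x n → x ^ᶠ n ≈ x ^ n
  ^ᶠ≈^ x zero    = refl
  ^ᶠ≈^ x (suc n) = *-congˡ (^ᶠ≈^ x n)

  ⁻¹-inverseˡ : ∀ x → ¬ (x ≈ 0#) → x ⁻¹ * x ≈ 1#
  ⁻¹-inverseˡ x x≉0 = trans (*-comm _ _) (⁻¹-inverse x x≉0)

  ⁻¹-* : ∀ x z → ¬ (x ≈ 0#) → ¬ (z ≈ 0#) → (x * z) ⁻¹ ≈ x ⁻¹ * z ⁻¹
  ⁻¹-* x z x≉0 z≉0 = begin
    (x * z) ⁻¹                                ≈⟨ *-identityʳ _ ⟨
    (x * z) ⁻¹ * 1#                           ≈⟨ *-congˡ (sym xz·x⁻¹z⁻¹≈1) ⟩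
    (x * z) ⁻¹ * ((x * z) * (x ⁻¹ * z ⁻¹))    ≈⟨ *-assoc _ _ _ ⟨
    ((x * z) ⁻¹ * (x * z)) * (x ⁻¹ * z ⁻¹)    ≈⟨ *-congʳ (⁻¹-inverseˡ (x * z) xz≉0) ⟩
    1# * (x ⁻¹ * z ⁻¹)                        ≈⟨ *-identityˡ _ ⟩
    x ⁻¹ * z ⁻¹                               ∎
    where
    xz·x⁻¹z⁻¹≈1 : (x * z) * (x ⁻¹ * z ⁻¹) ≈ 1#
    xz·x⁻¹z⁻¹≈1 = trans (interchange′ x z (x ⁻¹) (z ⁻¹))
                        (trans (*-cong (⁻¹-inverse x x≉0) (⁻¹-inverse z z≉0)) (*-identityˡ 1#))
      where open import Algebra.Properties.CommutativeSemigroup *-commutativeSemigroup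
              using () renaming (interchange to interchange′)
    xz≉0 : ¬ (x * z ≈ 0#)
    xz≉0 xz≈0 = 0≉1 (sym (trans (sym xz·x⁻¹z⁻¹≈1) (trans (*-congʳ xz≈0) (zeroˡ _))))

  Hupto-stable : ∀ v m j → j ≤ m → Hupto v m j ≡ H j v
  Hupto-stable v m j j≤m = go m (ℕ.≤⇒≤′ j≤m)
    where
    go : ∀ m → j ℕ.≤′ m → Hupto v m j ≡ H j v
    go m ℕ.≤′-refl = ≡.refl
    go (suc m) (ℕ.≤′-step j≤′m) with j ℕ.≤? m
    ... | yes _   = go m j≤′m
    ... | no  j≰m = ⊥-elim (j≰m (ℕ.≤′⇒≤ j≤′m))

  H-recurrence : ∀ v m → H (suc m) v ≈ (v - 1#) ⁻¹ * Σ (suc m) (λ i → ν (suc m C i) * H i v)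
  H-recurrence v m with suc m ℕ.≤? m
  ... | yes 1+m≤m = ⊥-elim (ℕ.<-irrefl ≡.refl 1+m≤m)
  ... | no  _     = *-congˡ (trans (sumTo≈Σ (suc m) _) (Σ-cong (suc m) (λ i i<1+m →
                      *-cong (fromℕ≈ν (suc m C i)) (reflexive (Hupto-stable v m i (ℕ.≤-pred i<1+m))))))

  module _ (v : Carrier) (v≉1 : ¬ (v ≈ 1#)) where
    v-1≉0 : ¬ (v - 1# ≈ 0#)
    v-1≉0 v-1≈0 = v≉1 (begin
      v                 ≈⟨ solve 1 (λ V → V := (V :- con (+ 1)) :+ con (+ 1)) refl v ⟩
      (v - 1#) + 1#     ≈⟨ +-congʳ v-1≈0 ⟩
      0# + 1#           ≈⟨ +-identityˡ 1# ⟩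
      1#                ∎)

    1-v≉0 : ¬ (1# - v ≈ 0#)
    1-v≉0 1-v≈0 = v≉1 (sym (begin
      1#                ≈⟨ solve 1 (λ V → con (+ 1) := (con (+ 1) :- V) :+ V) refl v ⟩
      (1# - v) + v      ≈⟨ +-congʳ 1-v≈0 ⟩
      0# + v            ≈⟨ +-identityˡ v ⟩
      v                 ∎))

    binomial-sum-H : ∀ m → Σ (suc (suc m)) (λ i → ν (suc m C i) * H i v) ≈ v * H (suc m) v
    binomial-sum-H m = begin
      Σ (suc m) (λ i → ν (suc m C i) * H i v) + ν (suc m C suc m) * H (suc m) v
        ≈⟨ +-cong lower-terms (trans (*-congʳ (reflexive (≡.cong ν (nCn≡1 (suc m))))) (*-identityˡ _)) ⟩
      (v - 1#) * H (suc m) v + H (suc m) v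
        ≈⟨ solve 2 (λ V Y → (V :- con (+ 1)) :* Y :+ Y := V :* Y) refl v (H (suc m) v) ⟩
      v * H (suc m) v ∎
      where
      lower-terms : Σ (suc m) (λ i → ν (suc m C i) * H i v) ≈ (v - 1#) * H (suc m) v
      lower-terms = sym (begin
        (v - 1#) * H (suc m) v      ≈⟨ *-congˡ (H-recurrence v m) ⟩
        (v - 1#) * ((v - 1#) ⁻¹ * _) ≈⟨ *-assoc _ _ _ ⟨
        ((v - 1#) * (v - 1#) ⁻¹) * _ ≈⟨ *-congʳ (⁻¹-inverse _ v-1≉0) ⟩
        1# * _                      ≈⟨ *-identityˡ _ ⟩
        _                           ∎)

    module GeneratingFunction (w K : Carrier) (w*v≈1 : w * v ≈ 1#) where
      λv : Carrier
      λv = v * (1# - v) ⁻¹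

      A B : Series
      A j = λv * H j v * K ^ j
      B n = w * K ^ n

      Hsum : ℕ → Carrier
      Hsum n = Σ (suc n) (λ i → ν (n C i) * H i v)

      A⊛B : ∀ n → (A ⊛ B) n ≈ (λv * w * K ^ n) * Hsum n
      A⊛B n = trans (Σ-cong (suc n) term) (sym (Σ-*ˡ (suc n) _ _))
        where
        term : ∀ j → j < suc n → ν (n C j) * A j * B (n ∸ j) ≈ (λv * w * K ^ n) * (ν (n C j) * H j v)
        term j j<1+n = begin
          ν (n C j) * (λv * H j v * K ^ j) * (w * K ^ (n ∸ j))
            ≈⟨ solve 6 (λ N L Hj Kj W Kr → N :* (L :* Hj :* Kj) :* (W :* Kr) := L :* W :* (Kj :* Kr) :* (N :* Hj))
                       refl (ν (n C j)) λv (H j v) (K ^ j) w (K ^ (n ∸ j)) ⟩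
          λv * w * (K ^ j * K ^ (n ∸ j)) * (ν (n C j) * H j v)
            ≈⟨ *-congʳ (*-congˡ (trans (sym (^-homo-* K j (n ∸ j))) (^-congʳ K (ℕ.m+[n∸m]≡n (ℕ.≤-pred j<1+n))))) ⟩
          λv * w * K ^ n * (ν (n C j) * H j v) ∎

      coefficient : ∀ n → (λv * w * K ^ n) * Hsum n - A n ≈ 𝟙 n
      coefficient zero = begin
        (λv * w * 1#) * (0# + 1# * 1#) - λv * 1# * 1#
          ≈⟨ solve 3 (λ V I W → V :* I :* W :* con (+ 1) :* (con (+ 0) :+ con (+ 1) :* con (+ 1)) :- V :* I :* con (+ 1) :* con (+ 1)
                              := (W :* V) :* (I :* (con (+ 1) :- V)) :+ (V :* I) :* (W :* V :- con (+ 1)))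
                     refl v ((1# - v) ⁻¹) w ⟩
        (w * v) * ((1# - v) ⁻¹ * (1# - v)) + λv * (w * v - 1#)
          ≈⟨ +-cong (*-cong w*v≈1 (⁻¹-inverseˡ (1# - v) 1-v≉0)) (*-congˡ (+-congʳ w*v≈1)) ⟩
        1# * 1# + λv * (1# - 1#)
          ≈⟨ solve 1 (λ X → con (+ 1) :* con (+ 1) :+ X :* (con (+ 1) :- con (+ 1)) := con (+ 1)) refl λv ⟩
        1# ∎
      coefficient (suc n) = begin
        (λv * w * K ^ suc n) * Hsum (suc n) - A (suc n)  ≈⟨ +-congʳ (*-congˡ (binomial-sum-H n)) ⟩
        (λv * w * K ^ suc n) * (v * H (suc n) v) - λv * H (suc n) v * K ^ suc n
          ≈⟨ solve 5 (λ L W Kn V Hn → L :* W :* Kn :* (V :* Hn) :- L :* Hn :* Kn := L :* Hn :* Kn :* (W :* V) :- L :* Hn :* Kn)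
                     refl λv w (K ^ suc n) v (H (suc n) v) ⟩
        A (suc n) * (w * v) - A (suc n)                  ≈⟨ +-congʳ (*-congˡ w*v≈1) ⟩
        A (suc n) * 1# - A (suc n)                       ≈⟨ solve 1 (λ X → X :* con (+ 1) :- X := con (+ 0)) refl _ ⟩
        0#                                               ∎

      inverse : A ⊛ (B ⊕ ⊝ 𝟙) ≋ 𝟙
      inverse n = begin
        (A ⊛ (B ⊕ ⊝ 𝟙)) n                  ≈⟨ ⊛-distribˡ A B (⊝ 𝟙) n ⟩
        (A ⊛ B) n + (A ⊛ ⊝ 𝟙) n            ≈⟨ +-cong (A⊛B n) (A⊛-𝟙 n) ⟩
        (λv * w * K ^ n) * Hsum n - A n    ≈⟨ coefficient n ⟩
        𝟙 n                                ∎
        where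
        A⊛-𝟙 : ∀ n → (A ⊛ ⊝ 𝟙) n ≈ - A n
        A⊛-𝟙 n = trans (⊛-comm A (⊝ 𝟙) n) (trans (⊛-cong {A = ⊝ 𝟙} {A′ = κ (- 1#)} {B = A} {B′ = A} neg-κ (λ _ → refl) n)
                   (trans (κ-⊛ (- 1#) A n) (trans (sym (-‿distribˡ-* 1# (A n))) (-‿cong (*-identityˡ _)))))
          where neg-κ : ⊝ 𝟙 ≋ κ (- 1#)
                neg-κ zero    = refl
                neg-κ (suc m) = -0#≈0#

-- Dividing the reciprocity law by hk (Y_k - 1)(Y_h - 1), purely algebraically:
-- in any commutative ring where A_k, A_h, G, I_k, I_h invert Y_k - 1, Y_h - 1,
-- y - 1, N_k, N_h, and G_m = (Y_m - 1)/(y - 1), the reciprocity law turns into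
--   I_k P_k A_k + I_h P_h A_h = A_k A_h + I_h I_k (- y G²) + G.
module ClearingDenominators {c ℓ} (R : CommutativeRing c ℓ) where
  open import Data.Integer using (+_)
  open RingToolkit R

  geometric-over-inverse : ∀ {y G Gₘ Yₘ Aₘ} → (y - 1#) * G ≈ 1# →
                           (y - 1#) * Gₘ ≈ Yₘ - 1# → (Yₘ - 1#) * Aₘ ≈ 1# → Gₘ * Aₘ ≈ G
  geometric-over-inverse {y} {G} {Gₘ} {Yₘ} {Aₘ} [y-1]G≈1 [y-1]Gₘ≈Yₘ-1 [Yₘ-1]Aₘ≈1 = begin
    Gₘ * Aₘ                      ≈⟨ *-identityʳ _ ⟨
    Gₘ * Aₘ * 1#                 ≈⟨ *-congˡ (sym [y-1]G≈1) ⟩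
    Gₘ * Aₘ * ((y - 1#) * G)
      ≈⟨ solve 4 (λ Gm Am Y G → Gm :* Am :* ((Y :- con (+ 1)) :* G) := ((Y :- con (+ 1)) :* Gm) :* Am :* G) refl Gₘ Aₘ y G ⟩
    ((y - 1#) * Gₘ) * Aₘ * G     ≈⟨ *-congʳ (*-congʳ [y-1]Gₘ≈Yₘ-1) ⟩
    (Yₘ - 1#) * Aₘ * G           ≈⟨ *-congʳ [Yₘ-1]Aₘ≈1 ⟩
    1# * G                       ≈⟨ *-identityˡ G ⟩
    G                            ∎

  divided-reciprocity : ∀ y Yₖ Yₕ Pₖ Pₕ Aₖ Aₕ G Gₖ Gₕ Iₖ Iₕ Nₕ Nₖ DG →
    Nₕ * ((Yₕ - 1#) * Pₖ) + Nₖ * ((Yₖ - 1#) * Pₕ) ≈ Nₕ * Nₖ - y * Gₖ * Gₕ + Nₕ * Nₖ * ((Yₖ - 1#) * Gₕ) →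
    (Yₖ - 1#) * Aₖ ≈ 1# → (Yₕ - 1#) * Aₕ ≈ 1# → (y - 1#) * G ≈ 1# →
    (y - 1#) * Gₖ ≈ Yₖ - 1# → (y - 1#) * Gₕ ≈ Yₕ - 1# →
    Nₕ * Iₕ ≈ 1# → Nₖ * Iₖ ≈ 1# → DG ≈ - (y * G * G) →
    Iₖ * (Pₖ * Aₖ) + Iₕ * (Pₕ * Aₕ) ≈ Aₖ * Aₕ + Iₕ * (Iₖ * DG) + G
  divided-reciprocity y Yₖ Yₕ Pₖ Pₕ Aₖ Aₕ G Gₖ Gₕ Iₖ Iₕ Nₕ Nₖ DG
                      reciprocity Aₖ-inv Aₕ-inv G-inv Gₖ-geo Gₕ-geo Iₕ-inv Iₖ-inv DG≈ = begin
    Iₖ * (Pₖ * Aₖ) + Iₕ * (Pₕ * Aₕ)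
      ≈⟨ solve 6 (λ Ik Ih Pk Ak Ph Ah → Ik :* (Pk :* Ak) :+ Ih :* (Ph :* Ah)
                 := Ik :* Pk :* Ak :* con (+ 1) :* con (+ 1) :+ Ih :* Ph :* Ah :* con (+ 1) :* con (+ 1))
                 refl Iₖ Iₕ Pₖ Aₖ Pₕ Aₕ ⟩
    Iₖ * Pₖ * Aₖ * 1# * 1# + Iₕ * Pₕ * Aₕ * 1# * 1#
      ≈⟨ +-cong (*-cong (*-congˡ (sym Iₕ-inv)) (sym Aₕ-inv)) (*-cong (*-congˡ (sym Iₖ-inv)) (sym Aₖ-inv)) ⟩
    Iₖ * Pₖ * Aₖ * (Nₕ * Iₕ) * ((Yₕ - 1#) * Aₕ) + Iₕ * Pₕ * Aₕ * (Nₖ * Iₖ) * ((Yₖ - 1#) * Aₖ)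
      ≈⟨ solve 10 (λ Ik Ih Pk Ak Ph Ah Nh Nk Yh Yk →
                     Ik :* Pk :* Ak :* (Nh :* Ih) :* ((Yh :- con (+ 1)) :* Ah) :+ Ih :* Ph :* Ah :* (Nk :* Ik) :* ((Yk :- con (+ 1)) :* Ak)
                  := (Ih :* Ik :* Ak :* Ah) :* (Nh :* ((Yh :- con (+ 1)) :* Pk) :+ Nk :* ((Yk :- con (+ 1)) :* Ph)))
                  refl Iₖ Iₕ Pₖ Aₖ Pₕ Aₕ Nₕ Nₖ Yₕ Yₖ ⟩
    (Iₕ * Iₖ * Aₖ * Aₕ) * (Nₕ * ((Yₕ - 1#) * Pₖ) + Nₖ * ((Yₖ - 1#) * Pₕ))
      ≈⟨ *-congˡ reciprocity ⟩
    (Iₕ * Iₖ * Aₖ * Aₕ) * (Nₕ * Nₖ - y * Gₖ * Gₕ + Nₕ * Nₖ * ((Yₖ - 1#) * Gₕ))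
      ≈⟨ solve 10 (λ Ih Ik Ak Ah Nh Nk Y Gk Gh Yk →
                     (Ih :* Ik :* Ak :* Ah) :* (Nh :* Nk :- Y :* Gk :* Gh :+ Nh :* Nk :* ((Yk :- con (+ 1)) :* Gh))
                  := (Nh :* Ih) :* (Nk :* Ik) :* (Ak :* Ah) :- Ih :* Ik :* Y :* (Gk :* Ak) :* (Gh :* Ah)
                     :+ (Nh :* Ih) :* (Nk :* Ik) :* ((Yk :- con (+ 1)) :* Ak) :* (Gh :* Ah))
                  refl Iₕ Iₖ Aₖ Aₕ Nₕ Nₖ y Gₖ Gₕ Yₖ ⟩
    (Nₕ * Iₕ) * (Nₖ * Iₖ) * (Aₖ * Aₕ) - Iₕ * Iₖ * y * (Gₖ * Aₖ) * (Gₕ * Aₕ)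
      + (Nₕ * Iₕ) * (Nₖ * Iₖ) * ((Yₖ - 1#) * Aₖ) * (Gₕ * Aₕ)
      ≈⟨ +-cong (+-cong (*-congʳ (*-cong Iₕ-inv Iₖ-inv)) (-‿cong (*-cong (*-congˡ Gₖ·Aₖ) Gₕ·Aₕ)))
                (*-cong (*-cong (*-cong Iₕ-inv Iₖ-inv) Aₖ-inv) Gₕ·Aₕ) ⟩
    1# * 1# * (Aₖ * Aₕ) - Iₕ * Iₖ * y * G * G + 1# * 1# * 1# * G
      ≈⟨ solve 6 (λ Ak Ah Ih Ik Y G → con (+ 1) :* con (+ 1) :* (Ak :* Ah) :- Ih :* Ik :* Y :* G :* G
                                     :+ con (+ 1) :* con (+ 1) :* con (+ 1) :* G
                                   := Ak :* Ah :+ Ih :* (Ik :* (:- (Y :* G :* G))) :+ G)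
                 refl Aₖ Aₕ Iₕ Iₖ y G ⟩
    Aₖ * Aₕ + Iₕ * (Iₖ * (- (y * G * G))) + G     ≈⟨ +-congʳ (+-congˡ (*-congˡ (*-congˡ (sym DG≈)))) ⟩
    Aₖ * Aₕ + Iₕ * (Iₖ * DG) + G                  ∎
    where
    Gₖ·Aₖ : Gₖ * Aₖ ≈ G
    Gₖ·Aₖ = geometric-over-inverse G-inv Gₖ-geo Aₖ-inv
    Gₕ·Aₕ : Gₕ * Aₕ ≈ G
    Gₕ·Aₕ = geometric-over-inverse G-inv Gₕ-geo Aₕ-inv

-- The series attached to u ≠ 0:  Y r = u^{-r} e^{rt}, so that y = Y 1 = u⁻¹ eᵗ
-- has powers yʳ = Y r.  Multiplying the generating function A_k of
-- Frobenius–Euler numbers at v = uᵏ by Y (ha mod k) produces exactly the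
-- summands of S_{n,uᵏ}(h,k): each side of the theorem is a coefficient of
-- k⁻¹ P_k(y) A_k.
module SeriesOfU {c ℓ} (F : Field c ℓ) (u : Field.Carrier F) (u≉0 : ¬ Field._≈_ F u (Field.0# F)) where
  open import Data.Nat as ℕ using (ℕ; zero; suc; _<_; _∸_)
  import Data.Nat.Properties as ℕ
  open import Data.Nat.DivMod using (_/_; _%_; m≡m%n+[m/n]*n)
  open import Data.Nat.Combinatorics using (_C_)
  open import Data.Integer using (+_)
  import Relation.Binary.PropositionalEquality as ≡

  open FrobeniusEuler F
  module Series = FiniteSums SeriesRing

  ū : Carrier
  ū = u ⁻¹

  ū^·u^ : ∀ t → ū ^ t * u ^ t ≈ 1#
  ū^·u^ t = trans (sym (^-distrib-* ū u t)) (trans (^-congˡ t (⁻¹-inverseˡ u u≉0)) (1^ t))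

  Y : ℕ → Series
  Y r n = ū ^ r * ν r ^ n

  Y-⊛ : ∀ a b → Y a ⊛ Y b ≋ Y (a ℕ.+ b)
  Y-⊛ a b n = begin
    (Y a ⊛ Y b) n                          ≈⟨ scale-⊛ (ū ^ a) (E (ν a)) (Y b) n ⟩
    ū ^ a * (E (ν a) ⊛ Y b) n              ≈⟨ *-congˡ (trans (⊛-comm (E (ν a)) (Y b) n)
                                                  (trans (scale-⊛ (ū ^ b) (E (ν b)) (E (ν a)) n)
                                                         (*-congˡ (⊛-comm (E (ν b)) (E (ν a)) n)))) ⟩
    ū ^ a * (ū ^ b * (E (ν a) ⊛ E (ν b)) n) ≈⟨ *-congˡ (*-congˡ (E-⊛ (ν a) (ν b) n)) ⟩
    ū ^ a * (ū ^ b * (ν a + ν b) ^ n)       ≈⟨ trans (sym (*-assoc _ _ _)) (*-cong (sym (^-homo-* ū a b)) (^-congˡ n (sym (ν-+ a b)))) ⟩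
    ū ^ (a ℕ.+ b) * ν (a ℕ.+ b) ^ n         ∎

  y : Series
  y = Y 1

  y^ : ∀ r → y Series.^ r ≋ Y r
  y^ zero    zero    = sym (*-identityˡ 1#)
  y^ zero    (suc n) = sym (trans (*-identityˡ _) (zeroˡ _))
  y^ (suc r) n       = trans (⊛-cong {A = y} {B = y Series.^ r} (λ _ → refl) (y^ r) n) (Y-⊛ 1 r n)

  module Side (p k′ : ℕ) (fk≉0 : ¬ (fromℕ (suc k′) ≈ 0#)) (uᵏ≉1 : ¬ (u ^ᶠ suc k′ ≈ 1#)) where
    k : ℕ
    k = suc k′

    v : Carrier
    v = u ^ᶠ k

    w*v≈1 : ū ^ k * v ≈ 1#
    w*v≈1 = trans (*-congˡ (^ᶠ≈^ u k)) (ū^·u^ k)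

    open GeneratingFunction v uᵏ≉1 (ū ^ k) (ν k) w*v≈1 public

    fk : Carrier
    fk = fromℕ k

    k·[r/k] : ∀ r → ν k * (fromℕ r * fk ⁻¹) ≈ ν r
    k·[r/k] r = begin
      ν k * (fromℕ r * fk ⁻¹)  ≈⟨ *-cong (sym (fromℕ≈ν k)) (*-congʳ (fromℕ≈ν r)) ⟩
      fk * (ν r * fk ⁻¹)       ≈⟨ x∙yz≈y∙xz fk (ν r) (fk ⁻¹) ⟩
      ν r * (fk * fk ⁻¹)       ≈⟨ *-congˡ (⁻¹-inverse fk fk≉0) ⟩
      ν r * 1#                 ≈⟨ *-identityʳ _ ⟩
      ν r                      ∎
      where open import Algebra.Properties.CommutativeSemigroup *-commutativeSemigroup using (x∙yz≈y∙xz)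

    ū^m·v^[m/k] : ∀ m → ū ^ m * v ^ᶠ (m / k) ≈ ū ^ (m % k)
    ū^m·v^[m/k] m = begin
      ū ^ m * v ^ᶠ q                        ≈⟨ *-cong (^-congʳ ū (m≡m%n+[m/n]*n m k)) (^ᶠ≈^ v q) ⟩
      ū ^ (r ℕ.+ q ℕ.* k) * v ^ q           ≈⟨ trans (*-congʳ (^-homo-* ū r (q ℕ.* k))) (*-assoc _ _ _) ⟩
      ū ^ r * (ū ^ (q ℕ.* k) * v ^ q)
        ≈⟨ *-congˡ (*-cong (trans (^-congʳ ū (ℕ.*-comm q k)) (sym (^-assocʳ ū k q))) (^-congˡ q (^ᶠ≈^ u k))) ⟩
      ū ^ r * ((ū ^ k) ^ q * (u ^ k) ^ q)   ≈⟨ *-congˡ (trans (sym (^-distrib-* (ū ^ k) (u ^ k) q)) (trans (^-congˡ q (ū^·u^ k)) (1^ q))) ⟩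
      ū ^ r * 1#                            ≈⟨ *-identityʳ _ ⟩
      ū ^ r                                 ∎
      where q = m / k
            r = m % k

    Hbar-coefficient : ∀ n m → λv * ν k ^ n * (ū ^ m * Hbar n m k v) ≈ (Y (m % k) ⊛ A) n
    Hbar-coefficient n m = begin
      λv * ν k ^ n * (ū ^ m * (v ^ᶠ (m / k) * Hpoly n x v))
        ≈⟨ *-congˡ (trans (sym (*-assoc _ _ _)) (*-congʳ (ū^m·v^[m/k] m))) ⟩
      λv * ν k ^ n * (ū ^ r * Hpoly n x v)
        ≈⟨ *-congˡ (*-congˡ (sumTo≈Σ (suc n) _)) ⟩
      λv * ν k ^ n * (ū ^ r * Σ (suc n) (λ j → fromℕ (n C j) * H j v * x ^ᶠ (n ∸ j)))
        ≈⟨ trans (*-congˡ (Σ-*ˡ (suc n) _ _)) (Σ-*ˡ (suc n) _ _) ⟩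
      Σ (suc n) (λ j → λv * ν k ^ n * (ū ^ r * (fromℕ (n C j) * H j v * x ^ᶠ (n ∸ j))))
        ≈⟨ Σ-cong (suc n) term ⟩
      (A ⊛ Y r) n                        ≈⟨ ⊛-comm A (Y r) n ⟩
      (Y r ⊛ A) n                        ∎
      where
      r = m % k
      x = fromℕ r * fk ⁻¹
      term : ∀ j → j < suc n → λv * ν k ^ n * (ū ^ r * (fromℕ (n C j) * H j v * x ^ᶠ (n ∸ j)))
                                ≈ ν (n C j) * A j * Y r (n ∸ j)
      term j j<1+n = begin
        λv * ν k ^ n * (ū ^ r * (fromℕ (n C j) * H j v * x ^ᶠ (n ∸ j)))
          ≈⟨ *-cong (*-congˡ (trans (^-congʳ (ν k) (≡.sym (ℕ.m+[n∸m]≡n (ℕ.≤-pred j<1+n)))) (^-homo-* (ν k) j (n ∸ j))))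
                    (*-congˡ (*-cong (*-congʳ (fromℕ≈ν (n C j))) (^ᶠ≈^ x (n ∸ j)))) ⟩
        λv * (ν k ^ j * ν k ^ (n ∸ j)) * (ū ^ r * (ν (n C j) * H j v * x ^ (n ∸ j)))
          ≈⟨ solve 7 (λ L Kj Kr U N Hj X → L :* (Kj :* Kr) :* (U :* (N :* Hj :* X)) := N :* (L :* Hj :* Kj) :* (U :* (Kr :* X)))
                     refl λv (ν k ^ j) (ν k ^ (n ∸ j)) (ū ^ r) (ν (n C j)) (H j v) (x ^ (n ∸ j)) ⟩
        ν (n C j) * A j * (ū ^ r * (ν k ^ (n ∸ j) * x ^ (n ∸ j)))
          ≈⟨ *-congˡ (*-congˡ (trans (sym (^-distrib-* (ν k) x (n ∸ j))) (^-congˡ (n ∸ j) (k·[r/k] r)))) ⟩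
        ν (n C j) * A j * Y r (n ∸ j) ∎

    S-as-coefficient : ∀ n → λv * fk ^ᶠ n * S n u p k ≈ fk ⁻¹ * Σ k (λ a → ν a * (Y ((p ℕ.* a) % k) ⊛ A) n)
    S-as-coefficient n = begin
      λv * fk ^ᶠ n * S n u p k
        ≈⟨ *-cong (*-congˡ (trans (^ᶠ≈^ fk n) (^-congˡ n (fromℕ≈ν k)))) (sumTo≈Σ k _) ⟩
      λv * ν k ^ n * Σ k (λ a → ū ^ᶠ (p ℕ.* a) * (fromℕ a * fk ⁻¹) * Hbar n (p ℕ.* a) k v) ≈⟨ Σ-*ˡ k _ _ ⟩
      Σ k (λ a → λv * ν k ^ n * (ū ^ᶠ (p ℕ.* a) * (fromℕ a * fk ⁻¹) * Hbar n (p ℕ.* a) k v)) ≈⟨ Σ-cong′ k term ⟩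
      Σ k (λ a → fk ⁻¹ * (ν a * (Y ((p ℕ.* a) % k) ⊛ A) n))                              ≈⟨ Σ-*ˡ k _ _ ⟨
      fk ⁻¹ * Σ k (λ a → ν a * (Y ((p ℕ.* a) % k) ⊛ A) n)                                ∎
      where
      term : ∀ a → λv * ν k ^ n * (ū ^ᶠ (p ℕ.* a) * (fromℕ a * fk ⁻¹) * Hbar n (p ℕ.* a) k v)
                   ≈ fk ⁻¹ * (ν a * (Y ((p ℕ.* a) % k) ⊛ A) n)
      term a = begin
        λv * ν k ^ n * (ū ^ᶠ (p ℕ.* a) * (fromℕ a * fk ⁻¹) * Hbar n (p ℕ.* a) k v)
          ≈⟨ *-congˡ (*-congʳ (*-cong (^ᶠ≈^ ū (p ℕ.* a)) (*-congʳ (fromℕ≈ν a)))) ⟩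
        λv * ν k ^ n * (ū ^ (p ℕ.* a) * (ν a * fk ⁻¹) * Hbar n (p ℕ.* a) k v)
          ≈⟨ solve 6 (λ L Kn U N I Hb → L :* Kn :* (U :* (N :* I) :* Hb) := I :* (N :* (L :* Kn :* (U :* Hb))))
                     refl λv (ν k ^ n) (ū ^ (p ℕ.* a)) (ν a) (fk ⁻¹) (Hbar n (p ℕ.* a) k v) ⟩
        fk ⁻¹ * (ν a * (λv * ν k ^ n * (ū ^ (p ℕ.* a) * Hbar n (p ℕ.* a) k v)))
          ≈⟨ *-congˡ (*-congˡ (Hbar-coefficient n (p ℕ.* a))) ⟩
        fk ⁻¹ * (ν a * (Y ((p ℕ.* a) % k) ⊛ A) n) ∎

module Assembly {c ℓ} (F : Field c ℓ) (char0 : FE.CharZero F) (h′ k′ : ℕ)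
                (coprime : gcd (suc h′) (suc k′) ≡ 1)
                (u : Field.Carrier F) (u≉0 : ¬ Field._≈_ F u (Field.0# F)) (u≉1 : ¬ Field._≈_ F u (Field.1# F))
                (uʰ≉1 : ¬ Field._≈_ F (FE._^_ F u (suc h′)) (Field.1# F))
                (uᵏ≉1 : ¬ Field._≈_ F (FE._^_ F u (suc k′)) (Field.1# F)) where
  open import Data.Nat as ℕ using (zero)
  open import Data.Nat.DivMod using (_%_)

  open FrobeniusEuler F
  open SeriesOfU F u u≉0
  open SeriesSums commutativeRing using (Σ-coefficient; ν-series)
  open SeriesInverse commutativeRing using (D-inverse)

  h k : ℕ
  h = suc h′
  k = suc k′

  fh fk : Carrier
  fh = fromℕ h
  fk = fromℕ k

  fh≉0 : ¬ (fh ≈ 0#)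
  fh≉0 = char0 h (λ ())

  fk≉0 : ¬ (fk ≈ 0#)
  fk≉0 = char0 k (λ ())

  module Sideₖ = Side h k′ fk≉0 uᵏ≉1
  module Sideₕ = Side k h′ fh≉0 uʰ≉1
  module Recip = PolynomialReciprocity SeriesRing y

  Aₖ Aₕ Iₖ Iₕ G : Series
  Aₖ = Sideₖ.A
  Aₕ = Sideₕ.A
  Iₖ = κ (fk ⁻¹)
  Iₕ = κ (fh ⁻¹)
  -- G(t) = u/(eᵗ - u), the generating function of (u/(1-u)) H_j(u)
  G j = (u * (1# - u) ⁻¹) * H j u

  Pₖ Pₕ : Series
  Pₖ = Recip.Pk h k coprime
  Pₕ = Recip.Ph h k coprime

  inverse-series : ∀ (A B Y : Series) → A ⊛ (B ⊕ ⊝ 𝟙) ≋ 𝟙 → Y ≋ B → Series._-_ Y Series.1# ⊛ A ≋ 𝟙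
  inverse-series A B Y A-inv Y≋B j =
    trans (⊛-comm _ A j) (trans (⊛-cong {A = A} {B = Series._-_ Y Series.1#} (λ _ → refl) (λ m → +-congʳ (Y≋B m)) j) (A-inv j))

  G-inverse : Series._-_ y Series.1# ⊛ G ≋ 𝟙
  G-inverse j = trans (⊛-cong {A = Series._-_ y Series.1#} (λ _ → refl) G≋ j) (inverse-series G₁.A G₁.B y G₁.inverse (λ _ → refl) j)
    where
    module G₁ = GeneratingFunction u u≉1 (ū ^ 1) (ν 1) (trans (*-congʳ (*-identityʳ ū)) (⁻¹-inverseˡ u u≉0))
    G≋ : G ≋ G₁.A
    G≋ j = sym (trans (*-congˡ (1^ j)) (*-identityʳ _))

  ν-inverse : ∀ m → ¬ (fromℕ m ≈ 0#) → Series.ν m ⊛ κ (fromℕ m ⁻¹) ≋ 𝟙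
  ν-inverse m fm≉0 j = trans (⊛-cong {B = κ (fromℕ m ⁻¹)} (ν-series m) (λ _ → refl) j) (trans (κ-⊛-κ (ν m) _ j) (unit j))
    where
    unit : ∀ j → κ (ν m * fromℕ m ⁻¹) j ≈ 𝟙 j
    unit zero    = trans (*-congʳ (sym (fromℕ≈ν m))) (⁻¹-inverse _ fm≉0)
    unit (suc j) = refl

  series-identity : Iₖ ⊛ (Pₖ ⊛ Aₖ) ⊕ Iₕ ⊛ (Pₕ ⊛ Aₕ) ≋ Aₖ ⊛ Aₕ ⊕ Iₕ ⊛ (Iₖ ⊛ D G) ⊕ G
  series-identity = ClearingDenominators.divided-reciprocity SeriesRing
    y (y Series.^ k) (y Series.^ h) Pₖ Pₕ Aₖ Aₕ G (Recip.geo k) (Recip.geo h) Iₖ Iₕ (Series.ν h) (Series.ν k) (D G)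
    (Recip.reciprocity h k coprime)
    (inverse-series Aₖ Sideₖ.B _ Sideₖ.inverse (y^ k)) (inverse-series Aₕ Sideₕ.B _ Sideₕ.inverse (y^ h)) G-inverse
    (Recip.geometric-sum k) (Recip.geometric-sum h) (ν-inverse h fh≉0) (ν-inverse k fk≉0)
    (Series.trans (D-inverse _ G G-inverse) (Series.-‿cong (Series.*-congʳ {G} (Series.*-congʳ {G} D[y-1]))))
    where
    D[y-1] : D (Series._-_ y Series.1#) ≋ y
    D[y-1] j = trans (+-congˡ -0#≈0#) (trans (+-identityʳ _) (*-congˡ (*-identityˡ _)))

  weighted-coefficient : ∀ K (r : ℕ → ℕ) B n →
    (Series.Σ K (λ a → Series.ν a ⊛ y Series.^ r a) ⊛ B) n ≈ Σ K (λ a → ν a * (Y (r a) ⊛ B) n)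
  weighted-coefficient K r B n = begin
    (Series.Σ K (λ a → Series.ν a ⊛ y Series.^ r a) ⊛ B) n  ≈⟨ ⊛-comm _ B n ⟩
    (B ⊛ Series.Σ K (λ a → Series.ν a ⊛ y Series.^ r a)) n  ≈⟨ Series.Σ-*ˡ K B _ n ⟩
    Series.Σ K (λ a → B ⊛ (Series.ν a ⊛ y Series.^ r a)) n  ≈⟨ Σ-coefficient K _ n ⟩
    Σ K (λ a → (B ⊛ (Series.ν a ⊛ y Series.^ r a)) n)      ≈⟨ Σ-cong′ K term ⟩
    Σ K (λ a → ν a * (Y (r a) ⊛ B) n)                      ∎
    where
    term : ∀ a → (B ⊛ (Series.ν a ⊛ y Series.^ r a)) n ≈ ν a * (Y (r a) ⊛ B) n
    term a = begin
      (B ⊛ (Series.ν a ⊛ y Series.^ r a)) n  ≈⟨ ⊛-comm B _ n ⟩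
      ((Series.ν a ⊛ y Series.^ r a) ⊛ B) n  ≈⟨ ⊛-cong {B = B} (⊛-cong {A = Series.ν a} (ν-series a) (y^ (r a))) (λ _ → refl) n ⟩
      ((κ (ν a) ⊛ Y (r a)) ⊛ B) n           ≈⟨ ⊛-assoc (κ (ν a)) (Y (r a)) B n ⟩
      (κ (ν a) ⊛ (Y (r a) ⊛ B)) n           ≈⟨ κ-⊛ (ν a) (Y (r a) ⊛ B) n ⟩
      ν a * (Y (r a) ⊛ B) n                 ∎

  side-k : ∀ n → (u ^ᶠ k * (1# - u ^ᶠ k) ⁻¹) * fk ^ᶠ n * S n u h k ≈ (Iₖ ⊛ (Pₖ ⊛ Aₖ)) n
  side-k n = trans (Sideₖ.S-as-coefficient n)
               (sym (trans (κ-⊛ (fk ⁻¹) (Pₖ ⊛ Aₖ) n) (*-congˡ (weighted-coefficient k (λ a → (h ℕ.* a) % k) Aₖ n))))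

  side-h : ∀ n → (u ^ᶠ h * (1# - u ^ᶠ h) ⁻¹) * fh ^ᶠ n * S n u k h ≈ (Iₕ ⊛ (Pₕ ⊛ Aₕ)) n
  side-h n = trans (Sideₕ.S-as-coefficient n)
               (sym (trans (κ-⊛ (fh ⁻¹) (Pₕ ⊛ Aₕ) n) (*-congˡ (weighted-coefficient h (λ b → (k ℕ.* b) % h) Aₕ n))))

  convolution-coefficient : ∀ n →
    sumTo (suc n) (λ j → fromℕ (n C j) * ((u ^ᶠ k * (1# - u ^ᶠ k) ⁻¹) * H j (u ^ᶠ k) * fk ^ᶠ j)
                                      * ((u ^ᶠ h * (1# - u ^ᶠ h) ⁻¹) * H (n ∸ j) (u ^ᶠ h) * fh ^ᶠ (n ∸ j)))
    ≈ (Aₖ ⊛ Aₕ) n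
  convolution-coefficient n = trans (sumTo≈Σ (suc n) _) (Σ-cong′ (suc n) (λ j →
    *-cong (*-cong (fromℕ≈ν (n C j)) (*-congˡ (trans (^ᶠ≈^ fk j) (^-congˡ j (fromℕ≈ν k)))))
           (*-congˡ (trans (^ᶠ≈^ fh (n ∸ j)) (^-congˡ (n ∸ j) (fromℕ≈ν h))))))

  derivative-coefficient : ∀ n → (fh * fk) ⁻¹ * (u * (1# - u) ⁻¹) * H (suc n) u ≈ (Iₕ ⊛ (Iₖ ⊛ D G)) n
  derivative-coefficient n = sym (begin
    (Iₕ ⊛ (Iₖ ⊛ D G)) n                                  ≈⟨ trans (κ-⊛ (fh ⁻¹) (Iₖ ⊛ D G) n) (*-congˡ (κ-⊛ (fk ⁻¹) (D G) n)) ⟩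
    fh ⁻¹ * (fk ⁻¹ * ((u * (1# - u) ⁻¹) * H (suc n) u))   ≈⟨ trans (sym (*-assoc _ _ _)) (sym (*-assoc _ _ _)) ⟩
    fh ⁻¹ * fk ⁻¹ * (u * (1# - u) ⁻¹) * H (suc n) u      ≈⟨ *-congʳ (*-congʳ (⁻¹-* fh fk fh≉0 fk≉0)) ⟨
    (fh * fk) ⁻¹ * (u * (1# - u) ⁻¹) * H (suc n) u       ∎)

-- Compare the n-th coefficients of the series identity.
theorem1p2 : ∀ {c ℓ} (F : Field c ℓ) →
  let open Field F
      open FE F
  in CharZero →
     (n h k : ℕ) → n ≥ 1 → h ≥ 1 → k ≥ 1 → gcd h k ≡ 1 →
     (u : Carrier) → IsAlgebraic u → ¬ (u ≈ 0#) → ¬ (u ≈ 1#) →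
     ¬ (u ^ h ≈ 1#) → ¬ (u ^ k ≈ 1#) →
     (u ^ k * (1# - u ^ k) ⁻¹) * fromℕ k ^ n * S n u h k
       + (u ^ h * (1# - u ^ h) ⁻¹) * fromℕ h ^ n * S n u k h
     ≈ sumTo (suc n) (λ j →
          fromℕ (n C j)
            * ((u ^ k * (1# - u ^ k) ⁻¹) * H j (u ^ k) * fromℕ k ^ j)
            * ((u ^ h * (1# - u ^ h) ⁻¹) * H (n ∸ j) (u ^ h) * fromℕ h ^ (n ∸ j)))
       + (fromℕ h * fromℕ k) ⁻¹ * (u * (1# - u) ⁻¹) * H (suc n) u
       + (u * (1# - u) ⁻¹) * H n u
theorem1p2 F char0 n (suc h′) (suc k′) _ _ _ coprime u _ u≉0 u≉1 uʰ≉1 uᵏ≉1 = begin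
  _                                             ≈⟨ +-cong (side-k n) (side-h n) ⟩
  (Iₖ ⊛ (Pₖ ⊛ Aₖ) ⊕ Iₕ ⊛ (Pₕ ⊛ Aₕ)) n            ≈⟨ series-identity n ⟩
  (Aₖ ⊛ Aₕ ⊕ Iₕ ⊛ (Iₖ ⊛ D G) ⊕ G) n              ≈⟨ +-congʳ (+-cong (convolution-coefficient n) (derivative-coefficient n)) ⟨
  _                                             ∎
  where open Assembly F char0 h′ k′ coprime u u≉0 u≉1 uʰ≉1 uᵏ≉1
        open FrobeniusEuler F
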